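{- Let $x\in\Sigma^n$ and $s\in\mathbb{Z}_+$, and let $D$ be the table defined below. For every $0\le i\le j\le n$, we have $\frac13 D[\lfloor{\frac{i}{s}}\rfloor,\lfloor{\frac{j}{s}}\rfloor] \le \mathsf{fold}_{8s}(x(i\,..\, j])+(i\bmod s) - (j\bmod s) \le D[\lfloor{\frac{i}{s}}\rfloor,\lfloor{\frac{j}{s}}\rfloor]$. In particular, the value $D[0,\lfloor n/s\rfloor]+(n\bmod s)$ lies between $\mathsf{fold}_{8s}(x)$ and $3\,\mathsf{fold}_{8s}(x)$.
   Context: $\Sigma$ carries a fixed-point-free involution $a\mapsto\overline{a}$, extended to strings by $\overline{y[1]\cdots y[m]}=\overline{y[m]}\cdots\overline{y[1]}$. $x(i..j]=x[i+1]\cdots x[j]$. Let $m=\lfloor n/s\rfloor$. The table $D[a,b]$, $0\le a\le b\le m$, is defined by: $D[a,a]=0$; $D[a,a+1]=s$; and for $b\ge a+2$, $D[a,b]$ is the minimum (with $\min\emptyset=\infty$) of (i) $12s+D[a+d+2,b-d]$ over all $d\in[1..\lfloor\frac{b-a-2}{2}\rfloor]$ such that $\overline{x((b-d)s..bs]}$ is a substring of $x(as..(a+d+2)s]$, and (ii) $D[a,c]+D[c,b]$ over $c\in(a..b)$. A window is a nonempty integer interval; for a string $y$ of length $N$, a window alignment of $y$ is a set $\mathcal{S}=\{(w_1,w_1'),\dots,(w_k,w_k')\}$ of pairs of pairwise disjoint windows in $[1..N]$ such that $\{(s(w_i),s(w_i'))\}$ is a non-crossing matching (each $s(w_i)<s(w_i')$,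 distinct pairs $(a,b),(a',b')$ satisfy $a<b<a'<b'$ or $a<a'<b'<b$ up to swapping; $s(w)$ is the first index of $w$) and $y[w']=\overline{y[w]}$ for all pairs; with $P=\bigcup_i(w_i\cup w_i')$, $\mathsf{fold}_\rho(y,\mathcal{S})=N-|P|+\rho|\mathcal{S}|$, and $\mathsf{fold}_\rho(y)$ is its minimum over all window alignments of $y$. -}

module Defs where

open import Data.Nat using (ℕ; zero; suc; _+_; _*_; _∸_; _≤_; _<_; _⊓_; _/_)
open import Data.Nat.Properties using (_≤?_)
open import Data.List using (List; []; _∷_; _++_; take; drop; length; reverse; map; foldr; concat; concatMap; upTo)
open import Data.Nat.ListAction using (sum)
open import Data.List.Relation.Unary.AllPairs using (AllPairs)
open import Data.List.Relation.Unary.All using (All)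
open import Data.List.Relation.Binary.Infix.Heterogeneous using (Infix)
open import Data.List.Relation.Binary.Infix.Heterogeneous.Properties using (infix?)
open import Data.Product using (Σ; _×_; _,_; proj₁; proj₂)
open import Data.Sum using (_⊎_)
open import Relation.Binary.PropositionalEquality using (_≡_)
open import Relation.Binary.Definitions using (DecidableEquality)
open import Relation.Nullary using (does)
open import Data.Bool using (if_then_else_)

-- x(i..j] = x[i+1] ⋯ x[j]   (0-indexed cut positions)
sub : {A : Set} → List A → ℕ → ℕ → List A
sub x i j = take (j ∸ i) (drop i x)

barStr : {A : Set} → (A → A) → List A → List A
barStr bar y = reverse (map bar y)

-- Computed by recursion on the length ℓ = b - a, with a fuel argument
-- (fuel ℓ+1 always suffices, since all recursive calls are on strictly
-- shorter intervals).  Dlen f a ℓ = D[a, a+ℓ].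
--
-- For ℓ = k+2 ≥ 2 (b = a+k+2):
--  (ii) c = a+t, t ∈ [1..k+1]:  D[a,a+t] + D[a+t,b]
--  (i)  d ∈ [1..⌊k/2⌋] with bar(x((b-d)s..bs]) a substring of x(as..(a+d+2)s]:
--       12s + D[a+d+2, b-d]   (interval length k - 2d)
-- The set of (ii)-candidates is nonempty (t = 1), so the minimum is
-- finite; it is computed as a fold of _⊓_ seeded with the t = 1 candidate.

module _ {A : Set} (_≟_ : DecidableEquality A) (bar : A → A) (x : List A) (s : ℕ) where

  isSub : List A → List A → Set
  isSub u v = Infix _≡_ u v

  Dlen : ℕ → ℕ → ℕ → ℕ
  Dlen zero a ℓ = 0
  Dlen (suc f) a zero = 0
  Dlen (suc f) a (suc zero) = s
  Dlen (suc f) a (suc (suc k)) = foldr _⊓_ (cand2 1) (cands2 ++ cands1)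
    where
    ℓ = suc (suc k)
    b = a + ℓ
    cand2 : ℕ → ℕ
    cand2 t = Dlen f a t + Dlen f (a + t) (ℓ ∸ t)
    cands2 : List ℕ
    cands2 = map (λ t → cand2 (suc t)) (upTo (suc k))
    cand1 : ℕ → List ℕ
    cand1 d =
      if does (infix? _≟_ (barStr bar (sub x ((b ∸ d) * s) (b * s)))
                          (sub x (a * s) ((a + d + 2) * s)))
      then (12 * s + Dlen f (a + d + 2) (k ∸ 2 * d) ∷ [])
      else []
    cands1 : List ℕ
    cands1 = concatMap (λ d → cand1 (suc d)) (upTo (k / 2))

  D : ℕ → ℕ → ℕ
  D a b = Dlen (suc (b ∸ a)) a (b ∸ a)

-- Window alignments.  A window is a nonempty integer interval [l..r]
-- (1-indexed positions); s(w) = l.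

record Window : Set where
  constructor ⟦_,_⟧
  field
    lo : ℕ
    hi : ℕ
open Window public

size : Window → ℕ
size w = suc (hi w ∸ lo w)

InRange : ℕ → Window → Set
InRange N w = 1 ≤ lo w × lo w ≤ hi w × hi w ≤ N

Disjoint : Window → Window → Set
Disjoint w w′ = hi w < lo w′ ⊎ hi w′ < lo w

window : {A : Set} → List A → Window → List A
window y w = sub y (lo w ∸ 1) (hi w)

NonCrossing : ℕ × ℕ → ℕ × ℕ → Set
NonCrossing (a , b) (a′ , b′) =
    (b < a′ × a′ < b′)
  ⊎ (a < a′ × a′ < b′ × b′ < b)
  ⊎ (b′ < a × a < b)
  ⊎ (a′ < a × a < b × b < b′)

starts : Window × Window → ℕ × ℕ
starts (w , w′) = lo w , lo w′

allWindows : List (Window × Window) → List Window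
allWindows S = concatMap (λ p → proj₁ p ∷ proj₂ p ∷ []) S

IsWindowAlignment : {A : Set} → (A → A) → List A → List (Window × Window) → Set
IsWindowAlignment bar y S =
    All (InRange (length y)) (allWindows S)
  × AllPairs Disjoint (allWindows S)
  × All (λ p → lo (proj₁ p) < lo (proj₂ p)) S
  × AllPairs (λ p q → NonCrossing (starts p) (starts q)) S
  × All (λ p → window y (proj₂ p) ≡ barStr bar (window y (proj₁ p))) S

coveredSize : List (Window × Window) → ℕ
coveredSize S = sum (map size (allWindows S))

foldCost : {A : Set} → ℕ → List A → List (Window × Window) → ℕ
foldCost ρ y S = length y ∸ coveredSize S + ρ * length S

IsFold : {A : Set} → (A → A) → ℕ → List A → ℕ → Set
IsFold bar ρ y v =
    Σ (List (Window × Window)) (λ S → IsWindowAlignment bar y S × foldCost ρ y S ≡ v)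
  × (∀ S → IsWindowAlignment bar y S → v ≤ foldCost ρ y S)

{-# OPTIONS --safe #-}
-- Both bounds compare alignments of x(i..j] with derivations of D[⌊i/s⌋, ⌊j/s⌋].
-- Lower bound, by induction on j − i: extending by one unmatched position raises D[⌊i/s⌋,⌊j/s⌋] + 3 (j mod s)
-- by at most 3.  A pair of windows of length L starting at i + 1 costs 8s; if L < 3s it is charged as 2L
-- unmatched positions, and otherwise it covers d ≥ 1 whole blocks at each end, so the mirror image of the last
-- d blocks lies in the first d + 2 blocks and rule (i) of D charges 12s plus the inside of the pair.
-- Upper bound, by induction along an optimal derivation of D: rule (ii) concatenates alignments, and rule (i)
-- yields one pair of windows, the occurrence of the mirrored blocks cut to start after i, whose cost 8s plus
-- the at most 4s positions it leaves uncovered is within 12s.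
module Submission where

open import Defs
open import Data.Nat using (ℕ; NonZero; zero; suc; _+_; _*_; _∸_; _≤_; _<_; _⊓_; _/_; _%_; z≤n; s≤s; _≤?_; _<?_; >-nonZero⁻¹)
open import Data.Nat.Properties
open import Data.Nat.DivMod
open import Data.Nat.Induction using (<-rec)
open import Data.Nat.Tactic.RingSolver using (solve-∀)
open import Data.Bool using (if_then_else_)
open import Data.List using (List; []; _∷_; _++_; length; map; foldr; concat; concatMap; upTo; take; drop; reverse; filter; cartesianProduct; cartesianProductWith)
open import Data.List.Properties using (map-cong-local; length-take; length-drop; length-map; length-reverse; length-++; take-take; take-[]; take-all; take-map; drop-map; drop-drop; take++drop≡id; reverse-++; reverse-map; reverse-involutive; ++-assoc; map-∘; map-cong; map-id; ≡-dec)
open import Data.List.Membership.Propositional using (_∈_; find; lose)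
open import Data.List.Membership.Propositional.Properties using (∈-map⁺; ∈-map⁻; ∈-++⁺ˡ; ∈-++⁺ʳ; ∈-++⁻; ∈-upTo⁺; ∈-upTo⁻; ∈-concatMap⁺; ∈-concatMap⁻; ∈-cartesianProduct⁺; ∈-cartesianProductWith⁺; foldr-selective)
open import Data.List.Relation.Unary.Any using (here; there)
open import Data.List.Relation.Unary.All as All using (All; []; _∷_; all?)
open import Data.List.Relation.Unary.All.Properties as All using (all-filter)
open import Data.List.Relation.Unary.AllPairs as AllPairs using (AllPairs; []; _∷_; allPairs?)
open import Data.List.Relation.Unary.AllPairs.Properties as AllPairs using ()
open import Data.List.Relation.Binary.Infix.Heterogeneous using (Infix; here; there)
open import Data.List.Relation.Binary.Infix.Heterogeneous.Properties using (infix?)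
open import Data.List.Relation.Binary.Prefix.Heterogeneous using (Prefix; []; _∷_)
open import Data.Product using (Σ; _×_; _,_; proj₁; proj₂)
open import Data.Sum using (_⊎_; inj₁; inj₂)
open import Data.Empty using (⊥-elim)
open import Relation.Nullary using (Dec; yes; no; ¬_; does)
open import Relation.Nullary.Decidable using (¬?; _×-dec_; _⊎-dec_)
open import Relation.Binary.PropositionalEquality using (_≡_; _≢_; refl; sym; trans; cong; cong₂; subst; subst₂; module ≡-Reasoning)
open import Relation.Binary.Definitions using (DecidableEquality)

-- Segments of lists

seg : {B : Set} → List B → ℕ → ℕ → List B
seg y l n = take n (drop l y)

sub≡seg : {B : Set} (y : List B) (l n : ℕ) → sub y l (l + n) ≡ seg y l n
sub≡seg y l n = cong (λ m → take m (drop l y)) (m+n∸m≡n l n)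

length-seg : {B : Set} (y : List B) (l n : ℕ) → l + n ≤ length y → length (seg y l n) ≡ n
length-seg y l n l+n≤ = begin
  length (seg y l n)            ≡⟨ length-take n (drop l y) ⟩
  n ⊓ length (drop l y)         ≡⟨ cong (n ⊓_) (length-drop l y) ⟩
  n ⊓ (length y ∸ l)            ≡⟨ m≤n⇒m⊓n≡m (subst (_≤ length y ∸ l) (m+n∸m≡n l n) (∸-monoˡ-≤ l l+n≤)) ⟩
  n                             ∎
  where open ≡-Reasoning

drop-take : {B : Set} (p n : ℕ) (z : List B) → drop p (take n z) ≡ take (n ∸ p) (drop p z)
drop-take zero    n       z       = refl
drop-take (suc p) zero    z       = refl
drop-take (suc p) (suc n) []      = sym (take-[] (n ∸ p))
drop-take (suc p) (suc n) (_ ∷ z) = drop-take p n z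

seg-seg : {B : Set} (y : List B) (l n p m : ℕ) → p + m ≤ n → seg (seg y l n) p m ≡ seg y (l + p) m
seg-seg y l n p m p+m≤n = begin
  take m (drop p (take n (drop l y)))       ≡⟨ cong (take m) (drop-take p n (drop l y)) ⟩
  take m (take (n ∸ p) (drop p (drop l y))) ≡⟨ take-take m (n ∸ p) _ ⟩
  take (m ⊓ (n ∸ p)) (drop p (drop l y))    ≡⟨ cong₂ take (m≤n⇒m⊓n≡m m≤n∸p) (drop-drop l p y) ⟩
  take m (drop (l + p) y)                   ∎
  where
  open ≡-Reasoning
  m≤n∸p : m ≤ n ∸ p
  m≤n∸p = subst (_≤ n ∸ p) (m+n∸m≡n p m) (∸-monoˡ-≤ p p+m≤n)

seg-++-middle : {B : Set} (u v w : List B) → seg (u ++ v ++ w) (length u) (length v) ≡ v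
seg-++-middle []      []      w = refl
seg-++-middle []      (b ∷ v) w = cong (b ∷_) (seg-++-middle [] v w)
seg-++-middle (_ ∷ u) v       w = seg-++-middle u v w

take++seg++drop : {B : Set} (y : List B) (l n : ℕ) → y ≡ take l y ++ seg y l n ++ drop (l + n) y
take++seg++drop y l n = begin
  y                                          ≡⟨ take++drop≡id l y ⟨
  take l y ++ drop l y                       ≡⟨ cong (take l y ++_) (take++drop≡id n (drop l y)) ⟨
  take l y ++ seg y l n ++ drop n (drop l y) ≡⟨ cong (λ z → take l y ++ seg y l n ++ z) (drop-drop l n y) ⟩
  take l y ++ seg y l n ++ drop (l + n) y    ∎
  where open ≡-Reasoning

reverse-seg : {B : Set} (y : List B) (l n r : ℕ) → length y ≡ l + n + r → reverse (seg y l n) ≡ seg (reverse y) r n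
reverse-seg y l n r len = sym (begin
  seg (reverse y) r n                                   ≡⟨ cong (λ z → seg (reverse z) r n) (take++seg++drop y l n) ⟩
  seg (reverse (pre ++ mid ++ post)) r n                ≡⟨ cong (λ z → seg z r n) reverse-split ⟩
  seg (reverse post ++ reverse mid ++ reverse pre) r n  ≡⟨ cong₂ (seg (reverse post ++ reverse mid ++ reverse pre)) length-post length-mid ⟨
  seg (reverse post ++ reverse mid ++ reverse pre) (length (reverse post)) (length (reverse mid))
                                                        ≡⟨ seg-++-middle (reverse post) (reverse mid) (reverse pre) ⟩
  reverse mid                                           ∎)
  where
  open ≡-Reasoning
  pre  = take l y
  mid  = seg y l n
  post = drop (l + n) y
  reverse-split : reverse (pre ++ mid ++ post) ≡ reverse post ++ reverse mid ++ reverse pre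
  reverse-split = begin
    reverse (pre ++ mid ++ post)                ≡⟨ reverse-++ pre (mid ++ post) ⟩
    reverse (mid ++ post) ++ reverse pre        ≡⟨ cong (_++ reverse pre) (reverse-++ mid post) ⟩
    (reverse post ++ reverse mid) ++ reverse pre ≡⟨ ++-assoc (reverse post) (reverse mid) (reverse pre) ⟩
    reverse post ++ reverse mid ++ reverse pre  ∎
  length-mid : length (reverse mid) ≡ n
  length-mid = trans (length-reverse mid) (length-seg y l n (subst (l + n ≤_) (sym len) (m≤m+n (l + n) r)))
  length-post : length (reverse post) ≡ r
  length-post = begin
    length (reverse post)  ≡⟨ length-reverse post ⟩
    length post            ≡⟨ length-drop (l + n) y ⟩
    length y ∸ (l + n)     ≡⟨ cong (_∸ (l + n)) len ⟩
    l + n + r ∸ (l + n)    ≡⟨ m+n∸m≡n (l + n) r ⟩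
    r                      ∎

map-seg : {B C : Set} (f : B → C) (y : List B) (l n : ℕ) → map f (seg y l n) ≡ seg (map f y) l n
map-seg f y l n = trans (sym (take-map n (drop l y))) (cong (take n) (sym (drop-map l y)))

barStr-seg : {B : Set} (bar : B → B) (y : List B) (l n r : ℕ) → length y ≡ l + n + r
           → barStr bar (seg y l n) ≡ seg (barStr bar y) r n
barStr-seg bar y l n r len =
  trans (cong reverse (map-seg bar y l n)) (reverse-seg (map bar y) l n r (trans (length-map bar y) len))

barStr-involutive : {B : Set} (bar : B → B) → (∀ a → bar (bar a) ≡ a) → (y : List B) → barStr bar (barStr bar y) ≡ y
barStr-involutive bar bar-inv y = begin
  reverse (map bar (reverse (map bar y)))  ≡⟨ cong reverse (reverse-map bar (map bar y)) ⟩
  reverse (reverse (map bar (map bar y)))  ≡⟨ reverse-involutive _ ⟩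
  map bar (map bar y)                      ≡⟨ map-∘ y ⟨
  map (λ a → bar (bar a)) y                ≡⟨ map-cong bar-inv y ⟩
  map (λ a → a) y                          ≡⟨ map-id y ⟩
  y                                        ∎
  where open ≡-Reasoning

length-barStr : {B : Set} (bar : B → B) (y : List B) → length (barStr bar y) ≡ length y
length-barStr bar y = trans (length-reverse (map bar y)) (length-map bar y)

barStr-seg-mirror : {B : Set} (bar : B → B) → (∀ a → bar (bar a) ≡ a) → (y : List B) (i q L t n E : ℕ)
                  → q + L ≤ length y → L ≡ t + n + E → seg y q L ≡ barStr bar (seg y i L)
                  → barStr bar (seg y (q + t) n) ≡ seg y (i + E) n
barStr-seg-mirror bar bar-inv y i q L t n E q+L≤ L≡ mirror = begin
  barStr bar (seg y (q + t) n)               ≡⟨ cong (barStr bar) (seg-seg y q L t n t+n≤L) ⟨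
  barStr bar (seg (seg y q L) t n)           ≡⟨ barStr-seg bar (seg y q L) t n E (trans (length-seg y q L q+L≤) L≡) ⟩
  seg (barStr bar (seg y q L)) E n           ≡⟨ cong (λ z → seg (barStr bar z) E n) mirror ⟩
  seg (barStr bar (barStr bar (seg y i L))) E n ≡⟨ cong (λ z → seg z E n) (barStr-involutive bar bar-inv (seg y i L)) ⟩
  seg (seg y i L) E n                        ≡⟨ seg-seg y i L E n E+n≤L ⟩
  seg y (i + E) n                            ∎
  where
  open ≡-Reasoning
  t+n≤L : t + n ≤ L
  t+n≤L = subst (t + n ≤_) (sym L≡) (m≤m+n (t + n) E)
  E+n≤L : E + n ≤ L
  E+n≤L = subst (E + n ≤_) (sym (trans L≡ (+-comm (t + n) E))) (+-monoʳ-≤ E (m≤n+m n t))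

take-prefix : {B : Set} (m : ℕ) (z : List B) → Prefix _≡_ (take m z) z
take-prefix zero    z       = []
take-prefix (suc m) []      = []
take-prefix (suc m) (b ∷ z) = refl ∷ take-prefix m z

seg-infix : {B : Set} (z : List B) (p m : ℕ) → Infix _≡_ (seg z p m) z
seg-infix z       zero    m = here (take-prefix m z)
seg-infix []      (suc p) m = here (subst (λ u → Prefix _≡_ u []) (sym (take-[] m)) [])
seg-infix (_ ∷ z) (suc p) m = there (seg-infix z p m)

seg-infix-seg : {B : Set} (y : List B) (l n p m : ℕ) → p + m ≤ n → Infix _≡_ (seg y (l + p) m) (seg y l n)
seg-infix-seg y l n p m p+m≤n =
  subst (λ u → Infix _≡_ u (seg y l n)) (seg-seg y l n p m p+m≤n) (seg-infix (seg y l n) p m)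

prefix⇒take : {B : Set} {u v : List B} → Prefix _≡_ u v → length u ≤ length v × u ≡ take (length u) v
prefix⇒take []           = z≤n , refl
prefix⇒take (refl ∷ pre) = s≤s (proj₁ (prefix⇒take pre)) , cong (_ ∷_) (proj₂ (prefix⇒take pre))

infix⇒seg : {B : Set} {u v : List B} → Infix _≡_ u v → Σ ℕ λ p → p + length u ≤ length v × u ≡ seg v p (length u)
infix⇒seg (here pre) = 0 , prefix⇒take pre
infix⇒seg (there inf) with infix⇒seg inf
... | p , bound , u≡ = suc p , s≤s bound , u≡

length-window : {A : Set} (y : List A) (w : Window) → 1 ≤ lo w → lo w ≤ hi w → hi w ≤ length y → length (window y w) ≡ size w
length-window y ⟦ suc l , h ⟧ _ l<h h≤ = begin
  length (seg y l (h ∸ l)) ≡⟨ length-seg y l (h ∸ l) (subst (_≤ length y) (sym (m+[n∸m]≡n (<⇒≤ l<h))) h≤) ⟩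
  h ∸ l                    ≡⟨ +-∸-assoc 1 l<h ⟩
  suc (h ∸ suc l)          ∎
  where open ≡-Reasoning

size-after : ∀ q n → 1 ≤ n → size ⟦ suc q , q + n ⟧ ≡ n
size-after q (suc n) _ = cong suc (trans (cong (_∸ suc q) (+-suc q n)) (m+n∸m≡n (suc q) n))

-- Window alignments inside an interval

Pair : Set
Pair = Window × Window

Both : (Window → Set) → Pair → Set
Both P (w , w′) = P w × P w′

Across : (Window → Window → Set) → Pair → Pair → Set
Across R (w , w′) q = Both (R w) q × Both (R w′) q

Compatible : Pair → Pair → Set
Compatible p q = Across Disjoint p q × NonCrossing (starts p) (starts q)

module _ {A : Set} (bar : A → A) where

  PairIn : List A → ℕ → ℕ → Pair → Set
  PairIn y l r (w , w′) =
    l < lo w × lo w ≤ hi w × hi w < lo w′ × lo w′ ≤ hi w′ × hi w′ ≤ r × window y w′ ≡ barStr bar (window y w)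

  AlignmentIn : List A → ℕ → ℕ → List Pair → Set
  AlignmentIn y l r S = All (PairIn y l r) S × AllPairs Compatible S

All-allWindows⁻ : {P : Window → Set} (S : List Pair) → All P (allWindows S) → All (Both P) S
All-allWindows⁻ []      []            = []
All-allWindows⁻ (_ ∷ S) (pw ∷ pw′ ∷ ps) = (pw , pw′) ∷ All-allWindows⁻ S ps

All-allWindows⁺ : {P : Window → Set} (S : List Pair) → All (Both P) S → All P (allWindows S)
All-allWindows⁺ []      []                = []
All-allWindows⁺ (_ ∷ S) ((pw , pw′) ∷ ps) = pw ∷ pw′ ∷ All-allWindows⁺ S ps

AllPairs-allWindows⁻ : {R : Window → Window → Set} (S : List Pair) → AllPairs R (allWindows S)
                     → All (λ p → R (proj₁ p) (proj₂ p)) S × AllPairs (Across R) S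
AllPairs-allWindows⁻ []      []                       = [] , []
AllPairs-allWindows⁻ (_ ∷ S) ((r ∷ rw) ∷ rw′ ∷ rest) =
  r ∷ proj₁ (AllPairs-allWindows⁻ S rest) ,
  All.zip (All-allWindows⁻ S rw , All-allWindows⁻ S rw′) ∷ proj₂ (AllPairs-allWindows⁻ S rest)

AllPairs-allWindows⁺ : {R : Window → Window → Set} (S : List Pair) → All (λ p → R (proj₁ p) (proj₂ p)) S
                     → AllPairs (Across R) S → AllPairs R (allWindows S)
AllPairs-allWindows⁺ []      []       []          = []
AllPairs-allWindows⁺ (_ ∷ S) (r ∷ rs) (rq ∷ rqs) =
  (r ∷ All-allWindows⁺ S (proj₁ (All.unzip rq))) ∷ All-allWindows⁺ S (proj₂ (All.unzip rq)) ∷ AllPairs-allWindows⁺ S rs rqs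

module _ {A : Set} {bar : A → A} {y : List A} where

  windowAlignment⇒alignmentIn : ∀ S → IsWindowAlignment bar y S → AlignmentIn bar y 0 (length y) S
  windowAlignment⇒alignmentIn S (inRange , disjoint , starts< , nonCrossing , mirrored) =
    All.zipWith pairIn (All.zip (All-allWindows⁻ S inRange , proj₁ disjoint′) , All.zip (starts< , mirrored)) ,
    AllPairs.zip (proj₂ disjoint′ , nonCrossing)
    where
    disjoint′ = AllPairs-allWindows⁻ S disjoint
    pairIn : ∀ {p} → (Both (InRange (length y)) p × Disjoint (proj₁ p) (proj₂ p))
                   × (lo (proj₁ p) < lo (proj₂ p) × window y (proj₂ p) ≡ barStr bar (window y (proj₁ p)))
           → PairIn bar y 0 (length y) p
    pairIn ((((l₁ , l≤h , _) , (_ , l≤h′ , h′≤)) , inj₁ h<l′) , _ , eq) = l₁ , l≤h , h<l′ , l≤h′ , h′≤ , eq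
    pairIn ((((_ , l≤h , _) , (_ , l≤h′ , _)) , inj₂ h′<l) , l<l′ , _) =
      ⊥-elim (<-irrefl refl (<-trans (≤-<-trans l≤h′ h′<l) l<l′))

  alignmentIn⇒windowAlignment : ∀ S → AlignmentIn bar y 0 (length y) S → IsWindowAlignment bar y S
  alignmentIn⇒windowAlignment S (pairs , compatible) =
    All-allWindows⁺ S (All.map inRange pairs) ,
    AllPairs-allWindows⁺ S (All.map (λ pr → inj₁ (proj₁ (proj₂ (proj₂ pr)))) pairs) (AllPairs.map proj₁ compatible) ,
    All.map (λ (_ , l≤h , h<l′ , _) → ≤-<-trans l≤h h<l′) pairs ,
    AllPairs.map proj₂ compatible ,
    All.map (λ pr → proj₂ (proj₂ (proj₂ (proj₂ (proj₂ pr))))) pairs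
    where
    inRange : ∀ {p} → PairIn bar y 0 (length y) p → Both (InRange (length y)) p
    inRange (l₁ , l≤h , h<l′ , l≤h′ , h′≤ , _) =
      (l₁ , l≤h , ≤-trans (<⇒≤ h<l′) (≤-trans l≤h′ h′≤)) , (≤-trans l₁ (≤-trans l≤h (<⇒≤ h<l′)) , l≤h′ , h′≤)

mapWindow : (ℕ → ℕ) → Window → Window
mapWindow f w = ⟦ f (lo w) , f (hi w) ⟧

mapPair : (ℕ → ℕ) → Pair → Pair
mapPair f p = mapWindow f (proj₁ p) , mapWindow f (proj₂ p)

module _ (f g : ℕ → ℕ) (f<⇒g< : ∀ {m n} → f m < f n → g m < g n) where

  Disjoint-transport : ∀ w₁ w₂ → Disjoint (mapWindow f w₁) (mapWindow f w₂) → Disjoint (mapWindow g w₁) (mapWindow g w₂)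
  Disjoint-transport _ _ (inj₁ h₁<l₂) = inj₁ (f<⇒g< h₁<l₂)
  Disjoint-transport _ _ (inj₂ h₂<l₁) = inj₂ (f<⇒g< h₂<l₁)

  NonCrossing-transport : ∀ a b a′ b′ → NonCrossing (f a , f b) (f a′ , f b′) → NonCrossing (g a , g b) (g a′ , g b′)
  NonCrossing-transport _ _ _ _ (inj₁ (p , q))                   = inj₁ (f<⇒g< p , f<⇒g< q)
  NonCrossing-transport _ _ _ _ (inj₂ (inj₁ (p , q , r)))        = inj₂ (inj₁ (f<⇒g< p , f<⇒g< q , f<⇒g< r))
  NonCrossing-transport _ _ _ _ (inj₂ (inj₂ (inj₁ (p , q))))     = inj₂ (inj₂ (inj₁ (f<⇒g< p , f<⇒g< q)))
  NonCrossing-transport _ _ _ _ (inj₂ (inj₂ (inj₂ (p , q , r)))) = inj₂ (inj₂ (inj₂ (f<⇒g< p , f<⇒g< q , f<⇒g< r)))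

  Compatible-transport : ∀ p q → Compatible (mapPair f p) (mapPair f q) → Compatible (mapPair g p) (mapPair g q)
  Compatible-transport (w₁ , w₁′) (w₂ , w₂′) (((d₁₂ , d₁₂′) , (d₁′₂ , d₁′₂′)) , nc) =
    ((Disjoint-transport w₁ w₂ d₁₂ , Disjoint-transport w₁ w₂′ d₁₂′) ,
     (Disjoint-transport w₁′ w₂ d₁′₂ , Disjoint-transport w₁′ w₂′ d₁′₂′)) ,
    NonCrossing-transport (lo w₁) (lo w₁′) (lo w₂) (lo w₂′) nc

coveredSize-shift : ∀ i S → coveredSize (map (mapPair (i +_)) S) ≡ coveredSize S
coveredSize-shift i []             = refl
coveredSize-shift i ((w , w′) ∷ S) = cong₂ _+_ (size-shift w) (cong₂ _+_ (size-shift w′) (coveredSize-shift i S))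
  where
  size-shift : ∀ w → size (mapWindow (i +_) w) ≡ size w
  size-shift w = cong suc ([m+n]∸[m+o]≡n∸o i (hi w) (lo w))

window-sub : {A : Set} (x : List A) (i j : ℕ) (w : Window) → 1 ≤ lo w → lo w ≤ hi w → hi w ≤ j ∸ i
           → window (sub x i j) w ≡ window x (mapWindow (i +_) w)
window-sub x i j w 1≤l l≤h h≤ = begin
  seg (seg x i (j ∸ i)) (lo w ∸ 1) (hi w ∸ (lo w ∸ 1))
    ≡⟨ seg-seg x i (j ∸ i) (lo w ∸ 1) (hi w ∸ (lo w ∸ 1)) (subst (_≤ j ∸ i) (sym (m+[n∸m]≡n l-1≤h)) h≤) ⟩
  seg x (i + (lo w ∸ 1)) (hi w ∸ (lo w ∸ 1))
    ≡⟨ cong₂ (seg x) (sym i+l-1) (sym (trans (cong (i + hi w ∸_) i+l-1) ([m+n]∸[m+o]≡n∸o i (hi w) (lo w ∸ 1)))) ⟩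
  seg x (i + lo w ∸ 1) (i + hi w ∸ (i + lo w ∸ 1))
    ∎
  where
  open ≡-Reasoning
  l-1≤h : lo w ∸ 1 ≤ hi w
  l-1≤h = ≤-trans (m∸n≤m (lo w) 1) l≤h
  i+l-1 : i + lo w ∸ 1 ≡ i + (lo w ∸ 1)
  i+l-1 = +-∸-assoc i 1≤l

module Shift {A : Set} (bar : A → A) (x : List A) (i j : ℕ) (i≤j : i ≤ j) where

  shift unshift : ℕ → ℕ
  shift m = i + m
  unshift m = m ∸ i

  PairIn-shift : ∀ p → PairIn bar (sub x i j) 0 (j ∸ i) p → PairIn bar x i j (mapPair shift p)
  PairIn-shift (w , w′) (0<l , l≤h , h<l′ , l≤h′ , h′≤ , eq) =
    m<m+n i 0<l , +-monoʳ-≤ i l≤h , +-monoʳ-< i h<l′ , +-monoʳ-≤ i l≤h′ ,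
    subst (i + hi w′ ≤_) (m+[n∸m]≡n i≤j) (+-monoʳ-≤ i h′≤) ,
    trans (sym (window-sub x i j w′ (≤-trans 0<l (≤-trans l≤h (<⇒≤ h<l′))) l≤h′ h′≤))
          (trans eq (cong (barStr bar) (window-sub x i j w 0<l l≤h (≤-trans (<⇒≤ h<l′) (≤-trans l≤h′ h′≤)))))

  PairIn-unshift : ∀ p → PairIn bar x i j (mapPair shift p) → PairIn bar (sub x i j) 0 (j ∸ i) p
  PairIn-unshift (w , w′) (i<l , l≤h , h<l′ , l≤h′ , h′≤ , eq) =
    0<l , l≤h₀ , h<l′₀ , l≤h′₀ , h′≤₀ ,
    trans (window-sub x i j w′ (≤-trans 0<l (≤-trans l≤h₀ (<⇒≤ h<l′₀))) l≤h′₀ h′≤₀)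
          (trans eq (cong (barStr bar) (sym (window-sub x i j w 0<l l≤h₀ (≤-trans (<⇒≤ h<l′₀) (≤-trans l≤h′₀ h′≤₀))))))
    where
    0<l : 0 < lo w
    0<l = +-cancelˡ-< i 0 (lo w) (subst (_< i + lo w) (sym (+-identityʳ i)) i<l)
    l≤h₀ = +-cancelˡ-≤ i _ _ l≤h
    h<l′₀ = +-cancelˡ-< i _ _ h<l′
    l≤h′₀ = +-cancelˡ-≤ i _ _ l≤h′
    h′≤₀ : hi w′ ≤ j ∸ i
    h′≤₀ = subst (_≤ j ∸ i) (m+n∸m≡n i (hi w′)) (∸-monoˡ-≤ i h′≤)

  alignmentIn-shift : ∀ S → AlignmentIn bar (sub x i j) 0 (j ∸ i) S → AlignmentIn bar x i j (map (mapPair shift) S)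
  alignmentIn-shift S (pairs , compatible) =
    All.map⁺ (All.map (PairIn-shift _) pairs) ,
    AllPairs.map⁺ (AllPairs.map (Compatible-transport (λ m → m) shift (+-monoʳ-< i) _ _) compatible)

  alignmentIn-unshift : ∀ S → AlignmentIn bar x i j (map (mapPair shift) S) → AlignmentIn bar (sub x i j) 0 (j ∸ i) S
  alignmentIn-unshift S (pairs , compatible) =
    All.map (PairIn-unshift _) (All.map⁻ pairs) ,
    AllPairs.map (Compatible-transport shift (λ m → m) (+-cancelˡ-< i _ _) _ _) (AllPairs.map⁻ compatible)

  shift∘unshift : ∀ T → All (PairIn bar x i j) T → map (mapPair shift) (map (mapPair unshift) T) ≡ T
  shift∘unshift []                            []       = refl
  shift∘unshift ((⟦ l , h ⟧ , ⟦ l′ , h′ ⟧) ∷ T) ((i<l , l≤h , h<l′ , l≤h′ , _) ∷ ps) =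
    cong₂ _∷_ (cong₂ _,_ (cong₂ ⟦_,_⟧ (m+[n∸m]≡n i≤l) (m+[n∸m]≡n i≤h))
                         (cong₂ ⟦_,_⟧ (m+[n∸m]≡n i≤l′) (m+[n∸m]≡n i≤h′)))
              (shift∘unshift T ps)
    where
    i≤l = <⇒≤ i<l
    i≤h = ≤-trans i≤l l≤h
    i≤l′ = ≤-trans i≤h (<⇒≤ h<l′)
    i≤h′ = ≤-trans i≤l′ l≤h′

-- Existence of optimal alignments

argmin : {X : Set} {P : X → Set} → (∀ c → Dec (P c)) → (cost : X → ℕ) → (z : X) → P z → (cs : List X)
       → Σ X λ m → P m × cost m ≤ cost z × All (λ c → P c → cost m ≤ cost c) cs
argmin P? cost z Pz [] = z , Pz , ≤-refl , []
argmin P? cost z Pz (c ∷ cs) with argmin P? cost z Pz cs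
... | m , Pm , m≤z , m≤cs with P? c
...   | no ¬Pc = m , Pm , m≤z , (λ Pc → ⊥-elim (¬Pc Pc)) ∷ m≤cs
...   | yes Pc with cost c <? cost m
...     | yes c<m = c , Pc , ≤-trans (<⇒≤ c<m) m≤z , (λ _ → ≤-refl) ∷ All.map (λ h Pc′ → ≤-trans (<⇒≤ c<m) (h Pc′)) m≤cs
...     | no c≮m  = m , Pm , m≤z , (λ _ → ≮⇒≥ c≮m) ∷ m≤cs

listsUpTo : {X : Set} → List X → ℕ → List (List X)
listsUpTo xs zero    = [] ∷ []
listsUpTo xs (suc k) = [] ∷ cartesianProductWith _∷_ xs (listsUpTo xs k)

∈-listsUpTo : {X : Set} {xs : List X} (k : ℕ) (ys : List X) → length ys ≤ k → All (_∈ xs) ys → ys ∈ listsUpTo xs k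
∈-listsUpTo zero    []       _         _          = here refl
∈-listsUpTo (suc k) []       _         _          = here refl
∈-listsUpTo (suc k) (y ∷ ys) (s≤s len) (y∈ ∷ ys∈) = there (∈-cartesianProductWith⁺ _∷_ y∈ (∈-listsUpTo k ys len ys∈))

module _ {A : Set} (_≟_ : DecidableEquality A) (bar : A → A) (y : List A) where

  private
    N = length y

  InRange? : ∀ w → Dec (InRange N w)
  InRange? w = (1 ≤? lo w) ×-dec (lo w ≤? hi w) ×-dec (hi w ≤? N)

  Disjoint? : ∀ w w′ → Dec (Disjoint w w′)
  Disjoint? w w′ = (hi w <? lo w′) ⊎-dec (hi w′ <? lo w)

  NonCrossing? : ∀ p q → Dec (NonCrossing p q)
  NonCrossing? (a , b) (a′ , b′) =
    ((b <? a′) ×-dec (a′ <? b′)) ⊎-dec ((a <? a′) ×-dec (a′ <? b′) ×-dec (b′ <? b)) ⊎-dec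
    ((b′ <? a) ×-dec (a <? b)) ⊎-dec ((a′ <? a) ×-dec (a <? b) ×-dec (b <? b′))

  isWindowAlignment? : ∀ S → Dec (IsWindowAlignment bar y S)
  isWindowAlignment? S =
    all? InRange? (allWindows S) ×-dec allPairs? Disjoint? (allWindows S) ×-dec
    all? (λ p → lo (proj₁ p) <? lo (proj₂ p)) S ×-dec allPairs? (λ p q → NonCrossing? (starts p) (starts q)) S ×-dec
    all? (λ p → ≡-dec _≟_ (window y (proj₂ p)) (barStr bar (window y (proj₁ p)))) S

  windowsIn : List Window
  windowsIn = cartesianProductWith ⟦_,_⟧ (upTo (suc N)) (upTo (suc N))

  pairsIn : List Pair
  pairsIn = cartesianProduct windowsIn windowsIn

  ∈-windowsIn : ∀ w → InRange N w → w ∈ windowsIn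
  ∈-windowsIn w (_ , l≤h , h≤N) = ∈-cartesianProductWith⁺ ⟦_,_⟧ (∈-upTo⁺ (s≤s (≤-trans l≤h h≤N))) (∈-upTo⁺ (s≤s h≤N))

  ∈-pairsIn : ∀ S → All (InRange N) (allWindows S) → All (_∈ pairsIn) S
  ∈-pairsIn S inRange = All.map (λ (w∈ , w′∈) → ∈-cartesianProduct⁺ (∈-windowsIn _ w∈) (∈-windowsIn _ w′∈))
                                (All-allWindows⁻ S inRange)

  foldCost-[] : ∀ ρ → foldCost ρ y [] ≡ N
  foldCost-[] ρ = trans (cong (N +_) (*-zeroʳ ρ)) (+-identityʳ N)

  length≤foldCost : ∀ ρ → 1 ≤ ρ → ∀ S → length S ≤ foldCost ρ y S
  length≤foldCost ρ 1≤ρ S = ≤-trans (subst (_≤ ρ * length S) (*-identityˡ (length S)) (*-monoˡ-≤ (length S) 1≤ρ)) (m≤n+m _ _)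

  -- Alignments with more than N pairs cost more than the empty one, so only the finitely many with at most N pairs matter.
  fold-exists : ∀ ρ → 1 ≤ ρ → Σ ℕ (IsFold bar ρ y)
  fold-exists ρ 1≤ρ = foldCost ρ y m , (m , m-valid , refl) , minimal
    where
    best = argmin isWindowAlignment? (foldCost ρ y) [] ([] , [] , [] , [] , []) (listsUpTo pairsIn N)
    m = proj₁ best
    m-valid = proj₁ (proj₂ best)
    m≤[] = proj₁ (proj₂ (proj₂ best))
    minimal : ∀ S → IsWindowAlignment bar y S → foldCost ρ y m ≤ foldCost ρ y S
    minimal S valid with length S ≤? N
    ... | yes short = All.lookup (proj₂ (proj₂ (proj₂ best))) (∈-listsUpTo N S short (∈-pairsIn S (proj₁ valid))) valid
    ... | no long   = ≤-trans m≤[] (≤-trans (≤-reflexive (foldCost-[] ρ)) (≤-trans (<⇒≤ (≰⇒> long)) (length≤foldCost ρ 1≤ρ S)))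

-- The table D

foldr-⊓-≤-∈ : ∀ z xs {v} → v ∈ xs → foldr _⊓_ z xs ≤ v
foldr-⊓-≤-∈ z (v ∷ xs) (here refl) = m⊓n≤m v _
foldr-⊓-≤-∈ z (v ∷ xs) (there v∈)  = ≤-trans (m⊓n≤n v _) (foldr-⊓-≤-∈ z xs v∈)

2*m≤n⇒m≤n/2 : ∀ m n → 2 * m ≤ n → m ≤ n / 2
2*m≤n⇒m≤n/2 m n 2m≤n = subst (_≤ n / 2) (trans (cong (_/ 2) (*-comm 2 m)) (m*n/n≡m m 2)) (/-monoˡ-≤ 2 2m≤n)

m<n/2⇒2*[1+m]≤n : ∀ m n → m < n / 2 → 2 * suc m ≤ n
m<n/2⇒2*[1+m]≤n m n m<n/2 = ≤-trans (≤-trans (≤-reflexive (*-comm 2 (suc m))) (*-monoˡ-≤ 2 m<n/2)) (m/n*n≤m n 2)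

module Table {A : Set} (_≟_ : DecidableEquality A) (bar : A → A) (x : List A) (s : ℕ) where

  D[_,_] : ℕ → ℕ → ℕ
  D[ a , b ] = D _≟_ bar x s a b

  Dl : ℕ → ℕ → ℕ → ℕ
  Dl = Dlen _≟_ bar x s

  Mirror : ℕ → ℕ → ℕ → Set
  Mirror a b d = Infix _≡_ (barStr bar (sub x ((b ∸ d) * s) (b * s))) (sub x (a * s) ((a + d + 2) * s))

  mirror? : ∀ a b d → Dec (Mirror a b d)
  mirror? a b d = infix? _≟_ _ _

  -- Dl (suc f) a (2 + k) unfolds to minCandidate (Dl f) a k.
  split : (ℕ → ℕ → ℕ) → ℕ → ℕ → ℕ → ℕ
  split g a ℓ t = g a t + g (a + t) (ℓ ∸ t)

  mirrored : (ℕ → ℕ → ℕ) → ℕ → ℕ → ℕ → List ℕ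
  mirrored g a k d = if does (mirror? a (a + suc (suc k)) d) then 12 * s + g (a + d + 2) (k ∸ 2 * d) ∷ [] else []

  candidates : (ℕ → ℕ → ℕ) → ℕ → ℕ → List ℕ
  candidates g a k = map (λ t → split g a (suc (suc k)) (suc t)) (upTo (suc k)) ++ concatMap (λ d → mirrored g a k (suc d)) (upTo (k / 2))

  minCandidate : (ℕ → ℕ → ℕ) → ℕ → ℕ → ℕ
  minCandidate g a k = foldr _⊓_ (split g a (suc (suc k)) 1) (candidates g a k)

  minCandidate-cong : ∀ g h a k → (∀ a′ ℓ → ℓ < suc (suc k) → g a′ ℓ ≡ h a′ ℓ) → minCandidate g a k ≡ minCandidate h a k
  minCandidate-cong g h a k g≡h = cong₂ (foldr _⊓_)
    (cong₂ _+_ (g≡h a 1 (s≤s (s≤s z≤n))) (g≡h (a + 1) (suc k) ≤-refl))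
    (cong₂ _++_
      (map-cong-local (All.tabulate λ {t} t∈ →
        cong₂ _+_ (g≡h a (suc t) (s≤s (∈-upTo⁻ t∈))) (g≡h (a + suc t) (suc k ∸ t) (s≤s (m∸n≤m (suc k) t)))))
      (cong concat (map-cong (λ d →
        cong (λ v → if does (mirror? a (a + suc (suc k)) (suc d)) then 12 * s + v ∷ [] else [])
             (g≡h (a + suc d + 2) (k ∸ 2 * suc d) (≤-trans (s≤s (m∸n≤m k (2 * suc d))) (n≤1+n _))))
        (upTo (k / 2)))))

  Dl-fuel : ∀ f f′ a ℓ → ℓ < f → ℓ < f′ → Dl f a ℓ ≡ Dl f′ a ℓ
  Dl-fuel (suc f) (suc f′) a zero          _         _          = refl
  Dl-fuel (suc f) (suc f′) a (suc zero)    _         _          = refl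
  Dl-fuel (suc f) (suc f′) a (suc (suc k)) (s≤s ℓ<f) (s≤s ℓ<f′) =
    minCandidate-cong (Dl f) (Dl f′) a k (λ a′ ℓ ℓ< → Dl-fuel f f′ a′ ℓ (≤-trans ℓ< ℓ<f) (≤-trans ℓ< ℓ<f′))

  D≡Dl : ∀ a b m → b ∸ a ≡ m → D[ a , b ] ≡ Dl (suc m) a m
  D≡Dl a b m refl = refl

  Dl≡D : ∀ f a ℓ → ℓ < f → Dl f a ℓ ≡ D[ a , a + ℓ ]
  Dl≡D f a ℓ ℓ<f = trans (Dl-fuel f (suc ℓ) a ℓ ℓ<f ≤-refl) (sym (D≡Dl a (a + ℓ) ℓ (m+n∸m≡n a ℓ)))

  D-refl : ∀ a → D[ a , a ] ≡ 0
  D-refl a = D≡Dl a a 0 (n∸n≡0 a)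

  D-suc : ∀ a → D[ a , suc a ] ≡ s
  D-suc a = D≡Dl a (suc a) 1 (m+n∸n≡m 1 a)

  D-+2 : ∀ a k → D[ a , a + suc (suc k) ] ≡ minCandidate (Dl (suc (suc k))) a k
  D-+2 a k = D≡Dl a (a + suc (suc k)) (suc (suc k)) (m+n∸m≡n a (suc (suc k)))

  Dl-split≡D : ∀ a k t → t ≤ k → split (Dl (suc (suc k))) a (suc (suc k)) (suc t) ≡ D[ a , a + suc t ] + D[ a + suc t , a + suc (suc k) ]
  Dl-split≡D a k t t≤k = cong₂ _+_ (Dl≡D ℓ a (suc t) (s≤s (s≤s t≤k))) right
    where
    ℓ = suc (suc k)
    right : Dl ℓ (a + suc t) (suc k ∸ t) ≡ D[ a + suc t , a + suc (suc k) ]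
    right = trans (Dl≡D ℓ (a + suc t) (suc k ∸ t) (s≤s (m∸n≤m (suc k) t)))
                  (cong D[ a + suc t ,_] (trans (+-assoc a (suc t) (suc k ∸ t)) (cong (λ z → a + suc z) (m+[n∸m]≡n (m≤n⇒m≤1+n t≤k)))))

  mirror-end : ∀ a k d → 2 * d ≤ k → a + d + 2 + (k ∸ 2 * d) ≡ a + suc (suc k) ∸ d
  mirror-end a k d 2d≤k = sym (begin
    a + suc (suc k) ∸ d                             ≡⟨ cong (λ z → a + suc (suc z) ∸ d) (m+[n∸m]≡n 2d≤k) ⟨
    a + suc (suc (2 * d + (k ∸ 2 * d))) ∸ d         ≡⟨ cong (_∸ d) (rearrange a d (k ∸ 2 * d)) ⟩
    a + d + 2 + (k ∸ 2 * d) + d ∸ d                 ≡⟨ m+n∸n≡m _ d ⟩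
    a + d + 2 + (k ∸ 2 * d)                         ∎)
    where
    open ≡-Reasoning
    rearrange : ∀ a d r → a + suc (suc (2 * d + r)) ≡ a + d + 2 + r + d
    rearrange = solve-∀

  Dl-mirror≡D : ∀ a k d → 2 * d ≤ k → Dl (suc (suc k)) (a + d + 2) (k ∸ 2 * d) ≡ D[ a + d + 2 , a + suc (suc k) ∸ d ]
  Dl-mirror≡D a k d 2d≤k = trans (Dl≡D (suc (suc k)) (a + d + 2) (k ∸ 2 * d) (s≤s (≤-trans (m∸n≤m k (2 * d)) (n≤1+n k))))
                                 (cong D[ a + d + 2 ,_] (mirror-end a k d 2d≤k))

  D-split≤ : ∀ a t u → D[ a , a + t + u ] ≤ D[ a , a + t ] + D[ a + t , a + t + u ]
  D-split≤ a zero    u       rewrite +-identityʳ a | D-refl a = ≤-refl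
  D-split≤ a (suc t) zero    rewrite +-identityʳ (a + suc t) | D-refl (a + suc t) = m≤m+n _ 0
  D-split≤ a (suc t) (suc u) = begin
    D[ a , a + suc t + suc u ]                               ≡⟨ cong D[ a ,_] b≡ ⟩
    D[ a , a + suc (suc k) ]                                 ≡⟨ D-+2 a k ⟩
    minCandidate (Dl (suc (suc k))) a k                      ≤⟨ foldr-⊓-≤-∈ _ _ (∈-++⁺ˡ (∈-map⁺ _ (∈-upTo⁺ (s≤s (m≤m+n t u))))) ⟩
    split (Dl (suc (suc k))) a (suc (suc k)) (suc t)         ≡⟨ Dl-split≡D a k t (m≤m+n t u) ⟩
    D[ a , a + suc t ] + D[ a + suc t , a + suc (suc k) ]    ≡⟨ cong (λ z → D[ a , a + suc t ] + D[ a + suc t , z ]) b≡ ⟨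
    D[ a , a + suc t ] + D[ a + suc t , a + suc t + suc u ]  ∎
    where
    open ≤-Reasoning
    k = t + u
    b≡ : a + suc t + suc u ≡ a + suc (suc (t + u))
    b≡ = trans (+-assoc a (suc t) (suc u)) (cong (λ z → a + suc z) (+-suc t u))

  D-triangle : ∀ {a b c} → a ≤ c → c ≤ b → D[ a , b ] ≤ D[ a , c ] + D[ c , b ]
  D-triangle {a} {b} {c} a≤c c≤b =
    subst (λ z → D[ a , z ] ≤ D[ a , c ] + D[ c , z ]) (m+[n∸m]≡n c≤b)
      (subst (λ z → D[ a , z + (b ∸ c) ] ≤ D[ a , z ] + D[ z , z + (b ∸ c) ]) (m+[n∸m]≡n a≤c)
        (D-split≤ a (c ∸ a) (b ∸ c)))

  D-mirror≤ : ∀ a k d → 1 ≤ d → 2 * d ≤ k → Mirror a (a + suc (suc k)) d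
            → D[ a , a + suc (suc k) ] ≤ 12 * s + D[ a + d + 2 , a + suc (suc k) ∸ d ]
  D-mirror≤ a k (suc d) _ 2d≤k mirror = begin
    D[ a , a + suc (suc k) ]                      ≡⟨ D-+2 a k ⟩
    minCandidate (Dl ℓ) a k                       ≤⟨ foldr-⊓-≤-∈ _ (candidates (Dl ℓ) a k) (∈-++⁺ʳ _ cand∈) ⟩
    12 * s + Dl ℓ (a + suc d + 2) (k ∸ 2 * suc d) ≡⟨ cong (12 * s +_) (Dl-mirror≡D a k (suc d) 2d≤k) ⟩
    12 * s + D[ a + suc d + 2 , a + suc (suc k) ∸ suc d ] ∎
    where
    open ≤-Reasoning
    ℓ = suc (suc k)
    chosen : 12 * s + Dl ℓ (a + suc d + 2) (k ∸ 2 * suc d) ∈ mirrored (Dl ℓ) a k (suc d)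
    chosen with mirror? a (a + suc (suc k)) (suc d)
    ... | yes _      = here refl
    ... | no ¬mirror = ⊥-elim (¬mirror mirror)
    cand∈ = ∈-concatMap⁺ (λ d′ → mirrored (Dl ℓ) a k (suc d′)) (lose (∈-upTo⁺ (2*m≤n⇒m≤n/2 (suc d) k 2d≤k)) chosen)

  mirrored⁻ : ∀ g a k d {v} → v ∈ mirrored g a k d → Mirror a (a + suc (suc k)) d × v ≡ 12 * s + g (a + d + 2) (k ∸ 2 * d)
  mirrored⁻ g a k d v∈ with mirror? a (a + suc (suc k)) d
  mirrored⁻ g a k d (here v≡) | yes mirror = mirror , v≡

  D-attained : ∀ a k →
      (Σ ℕ λ t → 1 ≤ t × t ≤ suc k × D[ a , a + suc (suc k) ] ≡ D[ a , a + t ] + D[ a + t , a + suc (suc k) ])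
    ⊎ (Σ ℕ λ d → 1 ≤ d × 2 * d ≤ k × Mirror a (a + suc (suc k)) d
               × D[ a , a + suc (suc k) ] ≡ 12 * s + D[ a + d + 2 , a + suc (suc k) ∸ d ])
  D-attained a k with foldr-selective ⊓-sel (split (Dl ℓ) a ℓ 1) (candidates (Dl ℓ) a k)
    where ℓ = suc (suc k)
  ... | inj₁ D≡ = inj₁ (1 , ≤-refl , s≤s z≤n , trans (D-+2 a k) (trans D≡ (Dl-split≡D a k 0 z≤n)))
  ... | inj₂ D∈ with ∈-++⁻ (map (λ t → split (Dl (suc (suc k))) a (suc (suc k)) (suc t)) (upTo (suc k))) D∈
  ...   | inj₁ D∈splits with ∈-map⁻ _ D∈splits
  ...     | t , t∈ , D≡ = inj₁ (suc t , s≤s z≤n , ∈-upTo⁻ t∈ , trans (D-+2 a k) (trans D≡ (Dl-split≡D a k t (≤-pred (∈-upTo⁻ t∈)))))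
  D-attained a k | inj₂ D∈ | inj₂ D∈mirrored with find (∈-concatMap⁻ (λ d → mirrored (Dl (suc (suc k))) a k (suc d)) D∈mirrored)
  ... | d , d∈ , D∈d with mirrored⁻ (Dl (suc (suc k))) a k (suc d) D∈d
  ...   | mirror , D≡ = inj₂ (suc d , s≤s z≤n , 2d≤k , mirror , trans (D-+2 a k) (trans D≡ (cong (12 * s +_) (Dl-mirror≡D a k (suc d) 2d≤k))))
    where
    2d≤k = m<n/2⇒2*[1+m]≤n d k (∈-upTo⁻ d∈)

-- The lower bound

costOver : ℕ → ℕ → List Pair → ℕ
costOver ρ n S = n ∸ coveredSize S + ρ * length S

costOver-pair : ∀ ρ L m n Sᵢ Sₒ → coveredSize Sᵢ ≤ m → coveredSize Sₒ ≤ n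
  → ρ + costOver ρ m Sᵢ + costOver ρ n Sₒ
    ≡ (L + m + L + n) ∸ (L + (L + (coveredSize Sᵢ + coveredSize Sₒ))) + ρ * suc (length Sᵢ + length Sₒ)
costOver-pair ρ L m n Sᵢ Sₒ cᵢ≤m cₒ≤n =
  subst₂ (λ m′ n′ → ρ + (m′ ∸ cᵢ + ρ * lᵢ) + (n′ ∸ cₒ + ρ * lₒ) ≡ (L + m′ + L + n′) ∸ (L + (L + (cᵢ + cₒ))) + ρ * suc (lᵢ + lₒ))
    (m+[n∸m]≡n cᵢ≤m) (m+[n∸m]≡n cₒ≤n) (arith (m ∸ cᵢ) (n ∸ cₒ))
  where
  cᵢ = coveredSize Sᵢ
  cₒ = coveredSize Sₒ
  lᵢ = length Sᵢ
  lₒ = length Sₒ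
  regroup : ∀ L cᵢ xᵢ cₒ xₒ → L + (cᵢ + xᵢ) + L + (cₒ + xₒ) ≡ L + (L + (cᵢ + cₒ)) + (xᵢ + xₒ)
  regroup = solve-∀
  collect : ∀ ρ xᵢ lᵢ xₒ lₒ → ρ + (xᵢ + ρ * lᵢ) + (xₒ + ρ * lₒ) ≡ xᵢ + xₒ + ρ * suc (lᵢ + lₒ)
  collect = solve-∀
  arith : ∀ xᵢ xₒ → ρ + ((cᵢ + xᵢ) ∸ cᵢ + ρ * lᵢ) + ((cₒ + xₒ) ∸ cₒ + ρ * lₒ)
                  ≡ (L + (cᵢ + xᵢ) + L + (cₒ + xₒ)) ∸ (L + (L + (cᵢ + cₒ))) + ρ * suc (lᵢ + lₒ)
  arith xᵢ xₒ rewrite m+n∸m≡n cᵢ xᵢ | m+n∸m≡n cₒ xₒ | regroup L cᵢ xᵢ cₒ xₒ | m+n∸m≡n (L + (L + (cᵢ + cₒ))) (xᵢ + xₒ) =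
    collect ρ xᵢ lᵢ xₒ lₒ

coveredSize-++ : ∀ S T → coveredSize (S ++ T) ≡ coveredSize S + coveredSize T
coveredSize-++ []             T = refl
coveredSize-++ ((w , w′) ∷ S) T =
  trans (cong (λ z → size w + (size w′ + z)) (coveredSize-++ S T)) (r (size w) (size w′) (coveredSize S) (coveredSize T))
  where
  r : ∀ a b c d → a + (b + (c + d)) ≡ a + (b + c) + d
  r = solve-∀

module _ {P : Pair → Set} (P? : ∀ p → Dec (P p)) where

  coveredSize-filter : ∀ S → coveredSize S ≡ coveredSize (filter P? S) + coveredSize (filter (λ p → ¬? (P? p)) S)
  coveredSize-filter []             = refl
  coveredSize-filter ((w , w′) ∷ S) with P? (w , w′)
  ... | yes _ = trans (cong (λ z → size w + (size w′ + z)) (coveredSize-filter S)) (r (size w) (size w′) _ _)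
    where
    r : ∀ a b c d → a + (b + (c + d)) ≡ a + (b + c) + d
    r = solve-∀
  ... | no _  = trans (cong (λ z → size w + (size w′ + z)) (coveredSize-filter S)) (r (size w) (size w′) _ _)
    where
    r : ∀ a b c d → a + (b + (c + d)) ≡ c + (a + (b + d))
    r = solve-∀

  length-filter-split : ∀ S → length S ≡ length (filter P? S) + length (filter (λ p → ¬? (P? p)) S)
  length-filter-split []      = refl
  length-filter-split (p ∷ S) with P? p
  ... | yes _ = cong suc (length-filter-split S)
  ... | no _  = trans (cong suc (length-filter-split S)) (sym (+-suc _ _))

Disjoint-sym : ∀ {w₁ w₂} → Disjoint w₁ w₂ → Disjoint w₂ w₁
Disjoint-sym (inj₁ h₁<l₂) = inj₂ h₁<l₂
Disjoint-sym (inj₂ h₂<l₁) = inj₁ h₂<l₁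

NonCrossing-sym : ∀ {a b a′ b′} → NonCrossing (a , b) (a′ , b′) → NonCrossing (a′ , b′) (a , b)
NonCrossing-sym (inj₁ p)                 = inj₂ (inj₂ (inj₁ p))
NonCrossing-sym (inj₂ (inj₁ p))          = inj₂ (inj₂ (inj₂ p))
NonCrossing-sym (inj₂ (inj₂ (inj₁ p)))   = inj₁ p
NonCrossing-sym (inj₂ (inj₂ (inj₂ p)))   = inj₂ (inj₁ p)

Compatible-sym : ∀ {p q} → Compatible p q → Compatible q p
Compatible-sym (((d₁₂ , d₁₂′) , (d₁′₂ , d₁′₂′)) , nc) =
  ((Disjoint-sym d₁₂ , Disjoint-sym d₁′₂) , (Disjoint-sym d₁₂′ , Disjoint-sym d₁′₂′)) , NonCrossing-sym nc

All-remove : {P : Pair → Set} (S₁ : List Pair) {q : Pair} {S₂ : List Pair} → All P (S₁ ++ q ∷ S₂) → P q × All P (S₁ ++ S₂)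
All-remove []       (pq ∷ ps) = pq , ps
All-remove (_ ∷ S₁) (p ∷ ps)  = proj₁ (All-remove S₁ ps) , p ∷ proj₂ (All-remove S₁ ps)

AllPairs-remove : (S₁ : List Pair) {q : Pair} {S₂ : List Pair} → AllPairs Compatible (S₁ ++ q ∷ S₂)
                → All (Compatible q) (S₁ ++ S₂) × AllPairs Compatible (S₁ ++ S₂)
AllPairs-remove []       (cq ∷ cs) = cq , cs
AllPairs-remove (_ ∷ S₁) (c ∷ cs)  =
  Compatible-sym (proj₁ (All-remove S₁ c)) ∷ proj₁ (AllPairs-remove S₁ cs) , proj₂ (All-remove S₁ c) ∷ proj₂ (AllPairs-remove S₁ cs)

find-starting-at : ∀ K (S : List Pair) →
    (Σ (List Pair) λ S₁ → Σ Pair λ q → Σ (List Pair) λ S₂ → S ≡ S₁ ++ q ∷ S₂ × lo (proj₁ q) ≡ K)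
  ⊎ All (λ p → lo (proj₁ p) ≢ K) S
find-starting-at K []      = inj₂ []
find-starting-at K (p ∷ S) with lo (proj₁ p) ≟ K
... | yes l≡K = inj₁ ([] , p , S , refl , l≡K)
... | no l≢K with find-starting-at K S
...   | inj₁ (S₁ , q , S₂ , S≡ , l≡K) = inj₁ (p ∷ S₁ , q , S₂ , cong (p ∷_) S≡ , l≡K)
...   | inj₂ none                     = inj₂ (l≢K ∷ none)

divMod-+* : ∀ s .{{_ : NonZero s}} r q → r < s → (r + q * s) / s ≡ q × (r + q * s) % s ≡ r
divMod-+* s r q r<s = sym (*-cancelʳ-≡ q _ s (+-cancelˡ-≡ r _ _ r+qs≡)) , mod≡
  where
  n = r + q * s
  mod≡ : n % s ≡ r
  mod≡ = trans ([m+kn]%n≡m%n r q s) (m<n⇒m%n≡m r<s)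
  r+qs≡ : r + q * s ≡ r + (n / s) * s
  r+qs≡ = trans (m≡m%n+[m/n]*n n s) (cong (_+ (n / s) * s) mod≡)

divMod-* : ∀ s .{{_ : NonZero s}} q → (q * s) / s ≡ q × (q * s) % s ≡ 0
divMod-* s q = divMod-+* s 0 q (>-nonZero⁻¹ s)

module Lower {A : Set} (_≟_ : DecidableEquality A) (bar : A → A) (bar-inv : ∀ a → bar (bar a) ≡ a) (x : List A) (s : ℕ) .{{_ : NonZero s}} where

  open Table _≟_ bar x s

  -- ThirdD≤ i j c says  ⅓ D[⌊i/s⌋, ⌊j/s⌋] ≤ c + (i mod s) − (j mod s),  with both sides multiplied by 3 and no subtraction.
  ThirdD≤ : ℕ → ℕ → ℕ → Set
  ThirdD≤ i j c = D[ i / s , j / s ] + 3 * (j % s) ≤ 3 * (c + i % s)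

  ThirdD≤-mono : ∀ {i j c c′} → c ≤ c′ → ThirdD≤ i j c → ThirdD≤ i j c′
  ThirdD≤-mono {i} c≤c′ bound = ≤-trans bound (*-monoʳ-≤ 3 (+-monoˡ-≤ (i % s) c≤c′))

  ThirdD≤-concat : ∀ {i k j c₁ c₂} → i ≤ k → k ≤ j → ThirdD≤ i k c₁ → ThirdD≤ k j c₂ → ThirdD≤ i j (c₁ + c₂)
  ThirdD≤-concat {i} {k} {j} {c₁} {c₂} i≤k k≤j left right = +-cancelʳ-≤ (3 * (k % s)) _ _ (begin
    D[ i / s , j / s ] + 3 * (j % s) + 3 * (k % s)
      ≤⟨ +-monoˡ-≤ (3 * (k % s)) (+-monoˡ-≤ (3 * (j % s)) (D-triangle (/-monoˡ-≤ s i≤k) (/-monoˡ-≤ s k≤j))) ⟩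
    D[ i / s , k / s ] + D[ k / s , j / s ] + 3 * (j % s) + 3 * (k % s)
      ≡⟨ regroup D[ i / s , k / s ] D[ k / s , j / s ] (j % s) (k % s) ⟩
    (D[ i / s , k / s ] + 3 * (k % s)) + (D[ k / s , j / s ] + 3 * (j % s))
      ≤⟨ +-mono-≤ left right ⟩
    3 * (c₁ + i % s) + 3 * (c₂ + k % s)
      ≡⟨ regroup′ c₁ (i % s) c₂ (k % s) ⟩
    3 * (c₁ + c₂ + i % s) + 3 * (k % s)
      ∎)
    where
    open ≤-Reasoning
    regroup : ∀ d₁ d₂ J K → d₁ + d₂ + 3 * J + 3 * K ≡ (d₁ + 3 * K) + (d₂ + 3 * J)
    regroup = solve-∀
    regroup′ : ∀ c₁ I c₂ K → 3 * (c₁ + I) + 3 * (c₂ + K) ≡ 3 * (c₁ + c₂ + I) + 3 * K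
    regroup′ = solve-∀

  ThirdD≤-refl : ∀ i → ThirdD≤ i i 0
  ThirdD≤-refl i rewrite D-refl (i / s) = ≤-refl

  ThirdD≤-suc : ∀ i → ThirdD≤ i (suc i) 1
  ThirdD≤-suc i with suc (i % s) <? s
  ... | yes r+1<s = subst (λ z → ThirdD≤ i z 1) (sym i+1≡) (subst₂ (λ q r → D[ i / s , q ] + 3 * r ≤ 3 * (1 + i % s)) (sym q≡) (sym r≡) bound)
    where
    i+1≡ : suc i ≡ suc (i % s) + (i / s) * s
    i+1≡ = cong suc (m≡m%n+[m/n]*n i s)
    q≡ : (suc (i % s) + (i / s) * s) / s ≡ i / s
    q≡ = proj₁ (divMod-+* s (suc (i % s)) (i / s) r+1<s)
    r≡ : (suc (i % s) + (i / s) * s) % s ≡ suc (i % s)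
    r≡ = proj₂ (divMod-+* s (suc (i % s)) (i / s) r+1<s)
    bound : D[ i / s , i / s ] + 3 * suc (i % s) ≤ 3 * (1 + i % s)
    bound rewrite D-refl (i / s) = ≤-refl
  ... | no r+1≮s = subst (λ z → ThirdD≤ i z 1) (sym i+1≡) (subst₂ (λ q r → D[ i / s , q ] + 3 * r ≤ 3 * (1 + i % s)) (sym q≡) (sym r≡) bound)
    where
    r+1≡s : suc (i % s) ≡ s
    r+1≡s = ≤-antisym (m%n<n i s) (≮⇒≥ r+1≮s)
    i+1≡ : suc i ≡ suc (i / s) * s
    i+1≡ = trans (cong suc (m≡m%n+[m/n]*n i s)) (cong (_+ (i / s) * s) r+1≡s)
    q≡ : (suc (i / s) * s) / s ≡ suc (i / s)
    q≡ = proj₁ (divMod-* s (suc (i / s)))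
    r≡ : (suc (i / s) * s) % s ≡ 0
    r≡ = proj₂ (divMod-* s (suc (i / s)))
    bound : D[ i / s , suc (i / s) ] + 3 * 0 ≤ 3 * (1 + i % s)
    bound = subst (_≤ 3 * (1 + i % s)) (sym (trans (cong (_+ 3 * 0) (D-suc (i / s))) (+-identityʳ s)))
                  (subst (λ r → s ≤ 3 * r) (sym r+1≡s) (m≤m+n s _))

  ThirdD≤-length : ∀ i n → ThirdD≤ i (i + n) n
  ThirdD≤-length i zero    = subst (λ z → ThirdD≤ i z 0) (sym (+-identityʳ i)) (ThirdD≤-refl i)
  ThirdD≤-length i (suc n) = subst (λ z → ThirdD≤ i z (1 + n)) (sym (+-suc i n))
    (ThirdD≤-concat {c₁ = 1} {c₂ = n} (n≤1+n i) (m≤m+n (suc i) n) (ThirdD≤-suc i) (ThirdD≤-length (suc i) n))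

  ThirdD≤-aligned : ∀ a b c → ThirdD≤ (a * s) (b * s) c → D[ a , b ] ≤ 3 * c
  ThirdD≤-aligned a b c bound = begin
    D[ a , b ]                                              ≤⟨ m≤m+n _ _ ⟩
    D[ a , b ] + 3 * 0                                      ≡⟨ cong₂ (λ a′ r → D[ a′ , b ] + 3 * r) (proj₁ (divMod-* s a)) (proj₂ (divMod-* s b)) ⟨
    D[ (a * s) / s , b ] + 3 * ((b * s) % s)                ≡⟨ cong (λ b′ → D[ (a * s) / s , b′ ] + 3 * ((b * s) % s)) (proj₁ (divMod-* s b)) ⟨
    D[ (a * s) / s , (b * s) / s ] + 3 * ((b * s) % s)      ≤⟨ bound ⟩
    3 * (c + (a * s) % s)                                   ≡⟨ cong (λ r → 3 * (c + r)) (proj₂ (divMod-* s a)) ⟩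
    3 * (c + 0)                                             ≡⟨ cong (3 *_) (+-identityʳ c) ⟩
    3 * c                                                   ∎
    where open ≤-Reasoning

  ThirdD≤-intro : ∀ {i j c A′ a E b} → i ≡ A′ + a * s → A′ < s → j ≡ E + b * s → E < s
                → D[ a , b ] + 3 * E ≤ 3 * (c + A′) → ThirdD≤ i j c
  ThirdD≤-intro {c = c} {A′} {a} {E} {b} refl A′<s refl E<s bound
    rewrite proj₁ (divMod-+* s A′ a A′<s) | proj₂ (divMod-+* s A′ a A′<s)
          | proj₁ (divMod-+* s E b E<s) | proj₂ (divMod-+* s E b E<s) = bound

  -- Notation: a = ⌊i/s⌋, A′ = i mod s, b = ⌊e/s⌋, E = e mod s for the end e of the second window,
  -- and A′ + L = u + (2 + d) s.  Blocks a .. a+d+2 then contain the mirror image of the d blocks ending at b.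
  module LongPair (i L m c A′ a u d E b : ℕ)
                  (i≡ : i ≡ A′ + a * s) (A′<s : A′ < s)
                  (A′+L≡ : A′ + L ≡ u + (2 + d) * s) (u<s : u < s) (1≤d : 1 ≤ d)
                  (e≡ : i + L + m + L ≡ E + b * s) (E<s : E < s)
                  (e≤ : i + L + m + L ≤ length x) (mirror : seg x (i + L + m) L ≡ barStr bar (seg x i L))
                  (inner : ThirdD≤ (i + L) (i + L + m) c) where

    b≥ : a + 2 * d + 3 ≤ b
    b≥ = +4<+2⇒+3≤ (a + 2 * d) b (*-cancelʳ-< _ (a + 2 * d + 4) (b + 2) (begin-strict
      (a + 2 * d + 4) * s             ≡⟨ r₁ a d s ⟩
      a * s + 2 * ((2 + d) * s)       ≤⟨ +-monoʳ-≤ (a * s) (*-monoʳ-≤ 2 (m≤n+m ((2 + d) * s) u)) ⟩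
      a * s + 2 * (u + (2 + d) * s)   ≡⟨ cong (λ z → a * s + 2 * z) A′+L≡ ⟨
      a * s + 2 * (A′ + L)            ≡⟨ r₂ a s A′ L ⟩
      (A′ + a * s) + L + L + A′       ≡⟨ cong (λ z → z + L + L + A′) i≡ ⟨
      i + L + L + A′                  ≤⟨ +-monoˡ-≤ A′ (+-monoˡ-≤ L (m≤m+n (i + L) m)) ⟩
      i + L + m + L + A′              ≡⟨ cong (_+ A′) e≡ ⟩
      E + b * s + A′                  <⟨ +-mono-<-≤ (+-monoˡ-< (b * s) E<s) (<⇒≤ A′<s) ⟩
      s + b * s + s                   ≡⟨ r₃ b s ⟩
      (b + 2) * s                     ∎))
      where
      open ≤-Reasoning
      +4<+2⇒+3≤ : ∀ n b → n + 4 < b + 2 → n + 3 ≤ b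
      +4<+2⇒+3≤ n b lt = subst (_≤ b) (+-comm 3 n) (≤-pred (≤-pred (subst₂ _≤_ (cong suc (+-comm n 4)) (+-comm b 2) lt)))
      r₁ : ∀ a d s → (a + 2 * d + 4) * s ≡ a * s + 2 * ((2 + d) * s)
      r₁ = solve-∀
      r₂ : ∀ a s A′ L → a * s + 2 * (A′ + L) ≡ (A′ + a * s) + L + L + A′
      r₂ = solve-∀
      r₃ : ∀ b s → s + b * s + s ≡ (b + 2) * s
      r₃ = solve-∀

    g = b ∸ (a + 2 * d + 3)
    k = 2 * d + 1 + g

    b≡ : b ≡ a + suc (suc k)
    b≡ = trans (sym (m+[n∸m]≡n b≥)) (r a d g)
      where
      r : ∀ a d g → a + 2 * d + 3 + g ≡ a + suc (suc (2 * d + 1 + g))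
      r = solve-∀

    b∸d≡ : a + suc (suc k) ∸ d ≡ a + d + 3 + g
    b∸d≡ = trans (cong (_∸ d) (r a d g)) (m+n∸n≡m _ d)
      where
      r : ∀ a d g → a + suc (suc (2 * d + 1 + g)) ≡ a + d + 3 + g + d
      r = solve-∀

    A′+E≤ : A′ + E ≤ 2 * s + u
    A′+E≤ = ≤-trans (+-mono-≤ (<⇒≤ A′<s) (<⇒≤ E<s)) (subst (_≤ 2 * s + u) (cong (s +_) (+-identityʳ s)) (m≤m+n (2 * s) u))

    t = 2 * s + u ∸ (A′ + E)
    p = (a + (2 + d)) * s
    q = (a + d + 3 + g) * s

    t+A′+E≡ : t + (A′ + E) ≡ 2 * s + u
    t+A′+E≡ = m∸n+n≡m A′+E≤

    i+L≡ : i + L ≡ p + u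
    i+L≡ = trans (cong (_+ L) i≡) (trans (r A′ a s L) (trans (cong (a * s +_) A′+L≡) (r′ a s u d)))
      where
      r : ∀ A′ a s L → A′ + a * s + L ≡ a * s + (A′ + L)
      r = solve-∀
      r′ : ∀ a s u d → a * s + (u + (2 + d) * s) ≡ (a + (2 + d)) * s + u
      r′ = solve-∀

    i+L+m+t≡ : i + L + m + t ≡ q
    i+L+m+t≡ = +-cancelʳ-≡ (A′ + E + L) _ _ (begin
      i + L + m + t + (A′ + E + L)             ≡⟨ r₁ (i + L + m) t (A′ + E) L ⟩
      (i + L + m + L) + (t + (A′ + E))         ≡⟨ cong₂ _+_ e≡ t+A′+E≡ ⟩
      E + b * s + (2 * s + u)                  ≡⟨ cong (λ z → E + z * s + (2 * s + u)) (m+[n∸m]≡n b≥) ⟨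
      E + (a + 2 * d + 3 + g) * s + (2 * s + u) ≡⟨ r₂ E a d g s u ⟩
      q + E + (u + (2 + d) * s)                ≡⟨ cong (q + E +_) A′+L≡ ⟨
      q + E + (A′ + L)                         ≡⟨ r₃ q E A′ L ⟩
      q + (A′ + E + L)                         ∎)
      where
      open ≡-Reasoning
      r₁ : ∀ n t m L → n + t + (m + L) ≡ (n + L) + (t + m)
      r₁ = solve-∀
      r₂ : ∀ E a d g s u → E + (a + 2 * d + 3 + g) * s + (2 * s + u) ≡ (a + d + 3 + g) * s + E + (u + (2 + d) * s)
      r₂ = solve-∀
      r₃ : ∀ q E A′ L → q + E + (A′ + L) ≡ q + (A′ + E + L)
      r₃ = solve-∀

    D-inner : D[ a + (2 + d) , a + d + 3 + g ] ≤ 3 * (u + (c + t))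
    D-inner = ThirdD≤-aligned (a + (2 + d)) (a + d + 3 + g) (u + (c + t))
      (ThirdD≤-concat {c₁ = u} {c₂ = c + t} (subst (p ≤_) (sym i+L≡) (m≤m+n p u)) (subst (i + L ≤_) i+L+m+t≡ (≤-trans (m≤m+n (i + L) m) (m≤m+n _ t)))
        (subst (λ z → ThirdD≤ p z u) (sym i+L≡) (ThirdD≤-length p u))
        (ThirdD≤-concat {c₁ = c} {c₂ = t} (m≤m+n (i + L) m) (subst (i + L + m ≤_) i+L+m+t≡ (m≤m+n _ t)) inner
          (subst (λ z → ThirdD≤ (i + L + m) z t) i+L+m+t≡ (ThirdD≤-length (i + L + m) t))))

    L≡ : L ≡ t + d * s + E
    L≡ = +-cancelˡ-≡ A′ _ _ (begin
      A′ + L                  ≡⟨ A′+L≡ ⟩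
      u + (2 + d) * s         ≡⟨ r u d s ⟩
      d * s + (2 * s + u)     ≡⟨ cong (d * s +_) t+A′+E≡ ⟨
      d * s + (t + (A′ + E))  ≡⟨ r′ d s t A′ E ⟩
      A′ + (t + d * s + E)    ∎)
      where
      open ≡-Reasoning
      r : ∀ u d s → u + (2 + d) * s ≡ d * s + (2 * s + u)
      r = solve-∀
      r′ : ∀ d s t A′ E → d * s + (t + (A′ + E)) ≡ A′ + (t + d * s + E)
      r′ = solve-∀

    mirror-condition : Mirror a (a + suc (suc k)) d
    mirror-condition = subst₂ (λ l r → Infix _≡_ (barStr bar (sub x l r)) (sub x (a * s) ((a + d + 2) * s)))
      (cong (_* s) (sym b∸d≡)) (sym b*s≡)
      (subst₂ (Infix _≡_) (sym image≡) (sym block≡) (seg-infix-seg x (a * s) ((2 + d) * s) (A′ + E) (d * s) fits))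
      where
      b*s≡ : (a + suc (suc k)) * s ≡ q + d * s
      b*s≡ = r a d g s
        where
        r : ∀ a d g s → (a + suc (suc (2 * d + 1 + g))) * s ≡ (a + d + 3 + g) * s + d * s
        r = solve-∀
      image≡ : barStr bar (sub x q (q + d * s)) ≡ seg x (a * s + (A′ + E)) (d * s)
      image≡ = begin
        barStr bar (sub x q (q + d * s))          ≡⟨ cong (barStr bar) (sub≡seg x q (d * s)) ⟩
        barStr bar (seg x q (d * s))              ≡⟨ cong (λ z → barStr bar (seg x z (d * s))) i+L+m+t≡ ⟨
        barStr bar (seg x (i + L + m + t) (d * s)) ≡⟨ barStr-seg-mirror bar bar-inv x i (i + L + m) L t (d * s) E
                                                       e≤ L≡ mirror ⟩
        seg x (i + E) (d * s)                     ≡⟨ cong (λ z → seg x (z + E) (d * s)) i≡ ⟩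
        seg x (A′ + a * s + E) (d * s)            ≡⟨ cong (λ z → seg x z (d * s)) (r A′ a s E) ⟩
        seg x (a * s + (A′ + E)) (d * s)          ∎
        where
        open ≡-Reasoning
        r : ∀ A′ a s E → A′ + a * s + E ≡ a * s + (A′ + E)
        r = solve-∀
      block≡ : sub x (a * s) ((a + d + 2) * s) ≡ seg x (a * s) ((2 + d) * s)
      block≡ = trans (cong (sub x (a * s)) (r a d s)) (sub≡seg x (a * s) ((2 + d) * s))
        where
        r : ∀ a d s → (a + d + 2) * s ≡ a * s + (2 + d) * s
        r = solve-∀
      fits : A′ + E + d * s ≤ (2 + d) * s
      fits = ≤-trans (+-monoˡ-≤ (d * s) (+-mono-≤ (<⇒≤ A′<s) (<⇒≤ E<s))) (≤-reflexive (r d s))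
        where
        r : ∀ d s → s + s + d * s ≡ (2 + d) * s
        r = solve-∀

    D-outer : D[ a , b ] ≤ 12 * s + 3 * (u + (c + t))
    D-outer = begin
      D[ a , b ]                                ≡⟨ cong D[ a ,_] b≡ ⟩
      D[ a , a + suc (suc k) ]                  ≤⟨ D-mirror≤ a k d 1≤d (≤-trans (m≤m+n (2 * d) 1) (m≤m+n _ g)) mirror-condition ⟩
      12 * s + D[ a + d + 2 , a + suc (suc k) ∸ d ] ≡⟨ cong₂ (λ l r → 12 * s + D[ l , r ]) (trans (+-assoc a d 2) (cong (a +_) (+-comm d 2))) b∸d≡ ⟩
      12 * s + D[ a + (2 + d) , a + d + 3 + g ] ≤⟨ +-monoʳ-≤ (12 * s) D-inner ⟩
      12 * s + 3 * (u + (c + t))                ∎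
      where
      open ≤-Reasoning

    cost-bound : D[ a , b ] + 3 * E ≤ 3 * (8 * s + c + A′)
    cost-bound = +-cancelʳ-≤ (3 * A′) _ _ (begin
      D[ a , b ] + 3 * E + 3 * A′                   ≤⟨ +-monoˡ-≤ (3 * A′) (+-monoˡ-≤ (3 * E) D-outer) ⟩
      12 * s + 3 * (u + (c + t)) + 3 * E + 3 * A′   ≡⟨ r₁ s u c t E A′ ⟩
      12 * s + 3 * u + 3 * c + 3 * (t + (A′ + E))   ≡⟨ cong (λ z → 12 * s + 3 * u + 3 * c + 3 * z) t+A′+E≡ ⟩
      12 * s + 3 * u + 3 * c + 3 * (2 * s + u)      ≡⟨ r₂ s u c ⟩
      18 * s + 6 * u + 3 * c                        ≤⟨ +-monoˡ-≤ (3 * c) (+-monoʳ-≤ (18 * s) (*-monoʳ-≤ 6 (<⇒≤ u<s))) ⟩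
      18 * s + 6 * s + 3 * c                        ≡⟨ r₃ s c ⟩
      3 * (8 * s + c)                               ≤⟨ m≤m+n _ _ ⟩
      3 * (8 * s + c) + 6 * A′                      ≡⟨ r₄ s c A′ ⟩
      3 * (8 * s + c + A′) + 3 * A′                 ∎)
      where
      open ≤-Reasoning
      r₁ : ∀ s u c t E A′ → 12 * s + 3 * (u + (c + t)) + 3 * E + 3 * A′ ≡ 12 * s + 3 * u + 3 * c + 3 * (t + (A′ + E))
      r₁ = solve-∀
      r₂ : ∀ s u c → 12 * s + 3 * u + 3 * c + 3 * (2 * s + u) ≡ 18 * s + 6 * u + 3 * c
      r₂ = solve-∀
      r₃ : ∀ s c → 18 * s + 6 * s + 3 * c ≡ 3 * (8 * s + c)
      r₃ = solve-∀
      r₄ : ∀ s c A′ → 3 * (8 * s + c) + 6 * A′ ≡ 3 * (8 * s + c + A′) + 3 * A′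
      r₄ = solve-∀

    ThirdD≤-long : ThirdD≤ i (i + L + m + L) (8 * s + c)
    ThirdD≤-long = ThirdD≤-intro {c = 8 * s + c} {a = a} {b = b} i≡ A′<s e≡ E<s cost-bound

  ThirdD≤-pair : ∀ i L m c → i + L + m + L ≤ length x → seg x (i + L + m) L ≡ barStr bar (seg x i L)
               → ThirdD≤ (i + L) (i + L + m) c → ThirdD≤ i (i + L + m + L) (8 * s + c)
  ThirdD≤-pair i L m c e≤ mirror inner with L <? 3 * s
  ... | yes L<3s = ThirdD≤-mono short-cost
        (ThirdD≤-concat {c₁ = L} {c₂ = c + L} (m≤m+n i L) (≤-trans (m≤m+n (i + L) m) (m≤m+n _ L)) (ThirdD≤-length i L)
          (ThirdD≤-concat {c₁ = c} {c₂ = L} (m≤m+n (i + L) m) (m≤m+n _ L) inner (ThirdD≤-length (i + L + m) L)))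
    where
    open ≤-Reasoning
    short-cost : L + (c + L) ≤ 8 * s + c
    short-cost = begin
      L + (c + L)          ≡⟨ r L c ⟩
      (L + L) + c          ≤⟨ +-monoˡ-≤ c (+-mono-≤ (<⇒≤ L<3s) (<⇒≤ L<3s)) ⟩
      (3 * s + 3 * s) + c  ≡⟨ r′ s c ⟩
      6 * s + c            ≤⟨ +-monoˡ-≤ c (*-monoˡ-≤ s {6} {8} (s≤s (s≤s (s≤s (s≤s (s≤s (s≤s z≤n))))))) ⟩
      8 * s + c            ∎
      where
      r : ∀ L c → L + (c + L) ≡ (L + L) + c
      r = solve-∀
      r′ : ∀ s c → (3 * s + 3 * s) + c ≡ 6 * s + c
      r′ = solve-∀
  ... | no L≮3s = LongPair.ThirdD≤-long i L m c (i % s) (i / s) ((i % s + L) % s) d (e % s) (e / s)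
                    (m≡m%n+[m/n]*n i s) (m%n<n i s) A′+L≡ (m%n<n (i % s + L) s) 1≤d (m≡m%n+[m/n]*n e s) (m%n<n e s) e≤ mirror inner
    where
    e = i + L + m + L
    Q = (i % s + L) / s
    3≤Q : 3 ≤ Q
    3≤Q = subst (_≤ Q) (m*n/n≡m 3 s) (/-monoˡ-≤ s (≤-trans (≮⇒≥ L≮3s) (m≤n+m L (i % s))))
    d = Q ∸ 2
    1≤d : 1 ≤ d
    1≤d = ∸-monoˡ-≤ 2 3≤Q
    A′+L≡ : i % s + L ≡ (i % s + L) % s + (2 + d) * s
    A′+L≡ = trans (m≡m%n+[m/n]*n (i % s + L) s) (cong (λ z → (i % s + L) % s + z * s) (sym (m+[n∸m]≡n (≤-trans (s≤s (s≤s z≤n)) 3≤Q))))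

  record PairShape (i : ℕ) (w w′ : Window) : Set where
    field
      L m     : ℕ
      1≤L     : 1 ≤ L
      hi-w    : hi w ≡ i + L
      lo-w′   : lo w′ ≡ suc (i + L + m)
      hi-w′   : hi w′ ≡ i + L + m + L
      size-w  : size w ≡ L
      size-w′ : size w′ ≡ L
      mirror  : seg x (i + L + m) L ≡ barStr bar (seg x i L)

  pairShape : ∀ i N w w′ → lo w ≡ suc i → N ≤ length x → PairIn bar x i N (w , w′) → PairShape i w w′
  pairShape i N w w′ l≡ N≤ (_ , l≤h , h<l′ , l≤h′ , h′≤N , eq) = record
    { L = L ; m = m ; 1≤L = 1≤L ; hi-w = hi-w ; lo-w′ = lo-w′ ; hi-w′ = hi-w′ ; size-w = size-w ; size-w′ = size-w′
    ; mirror = trans (sym (trans (cong₂ (sub x) (cong (_∸ 1) lo-w′) hi-w′) (sub≡seg x (i + L + m) L)))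
                     (trans eq (cong (barStr bar) (trans (cong₂ (sub x) (cong (_∸ 1) l≡) hi-w) (sub≡seg x i L)))) }
    where
    L = hi w ∸ i
    hi-w : hi w ≡ i + L
    hi-w = sym (m+[n∸m]≡n (≤-trans (n≤1+n i) (subst (_≤ hi w) l≡ l≤h)))
    1≤L : 1 ≤ L
    1≤L = subst (_≤ L) (m+n∸m≡n i 1) (∸-monoˡ-≤ i (subst (_≤ hi w) (trans l≡ (+-comm 1 i)) l≤h))
    size-w : size w ≡ L
    size-w = trans (cong (λ l → size ⟦ l , hi w ⟧) l≡) (trans (cong (λ h → size ⟦ suc i , h ⟧) hi-w) (size-after i L 1≤L))
    1≤l : 1 ≤ lo w
    1≤l = subst (1 ≤_) (sym l≡) (s≤s z≤n)
    h′≤ : hi w′ ≤ length x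
    h′≤ = ≤-trans h′≤N N≤
    size-w′ : size w′ ≡ L
    size-w′ = begin
      size w′                   ≡⟨ length-window x w′ (≤-trans 1≤l (≤-trans l≤h (<⇒≤ h<l′))) l≤h′ h′≤ ⟨
      length (window x w′)      ≡⟨ cong length eq ⟩
      length (barStr bar (window x w)) ≡⟨ length-barStr bar (window x w) ⟩
      length (window x w)       ≡⟨ length-window x w 1≤l l≤h (≤-trans (<⇒≤ h<l′) (≤-trans l≤h′ h′≤)) ⟩
      size w                    ≡⟨ size-w ⟩
      L                         ∎
      where open ≡-Reasoning
    m = lo w′ ∸ suc (hi w)
    lo-w′ : lo w′ ≡ suc (i + L + m)
    lo-w′ = trans (sym (m+[n∸m]≡n h<l′)) (cong (λ h → suc h + m) hi-w)
    hi-w′ : hi w′ ≡ i + L + m + L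
    hi-w′ = begin
      hi w′                       ≡⟨ m+[n∸m]≡n l≤h′ ⟨
      lo w′ + (hi w′ ∸ lo w′)     ≡⟨ cong₂ _+_ lo-w′ (cong (_∸ 1) size-w′) ⟩
      suc (i + L + m) + (L ∸ 1)   ≡⟨ +-suc (i + L + m) (L ∸ 1) ⟨
      i + L + m + suc (L ∸ 1)     ≡⟨ cong (i + L + m +_) (m+[n∸m]≡n 1≤L) ⟩
      i + L + m + L               ∎
      where open ≡-Reasoning

  module _ {i N : ℕ} {w w′ : Window} (shape : PairShape i w w′) (l≡ : lo w ≡ suc i) (l≤h′ : lo w′ ≤ hi w′) where
    open PairShape shape

    PairIn-inside : ∀ r → PairIn bar x i N r → Compatible (w , w′) r → lo (proj₁ r) < lo w′
                  → PairIn bar x (i + L) (i + L + m) r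
    PairIn-inside (r , r′) (i<l , l≤h , h<l′ , l≤h′ᵣ , _ , eq) (((d , _) , (_ , d′)) , nc) l<l′ =
      after-w d , l≤h , h<l′ , l≤h′ᵣ , before-w′ d′ , eq
      where
      after-w : Disjoint w r → i + L < lo r
      after-w (inj₁ h<l) = subst (_< lo r) hi-w h<l
      after-w (inj₂ h<l) = ⊥-elim (<-irrefl refl (≤-<-trans l≤h (<-≤-trans h<l (subst (_≤ lo r) (sym l≡) i<l))))
      nested : NonCrossing (lo w , lo w′) (lo r , lo r′) → lo r′ < lo w′
      nested (inj₁ (l′<l , _))              = ⊥-elim (<-irrefl refl (<-trans l′<l l<l′))
      nested (inj₂ (inj₁ (_ , _ , l′ᵣ<l′))) = l′ᵣ<l′
      nested (inj₂ (inj₂ (inj₁ (l′ᵣ<l , _)))) =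
        ⊥-elim (<-irrefl refl (<-≤-trans l′ᵣ<l (subst (_≤ lo r′) (sym l≡) (≤-trans i<l (≤-trans l≤h (<⇒≤ h<l′))))))
      nested (inj₂ (inj₂ (inj₂ (l<lw , _)))) = ⊥-elim (<-irrefl refl (<-≤-trans l<lw (subst (_≤ lo r) (sym l≡) i<l)))
      before-w′ : Disjoint w′ r′ → hi r′ ≤ i + L + m
      before-w′ (inj₁ h′<l′ᵣ) = ⊥-elim (<-irrefl refl (<-trans (nested nc) (≤-<-trans l≤h′ h′<l′ᵣ)))
      before-w′ (inj₂ h′ᵣ<l′) = ≤-pred (subst (hi r′ <_) lo-w′ h′ᵣ<l′)

    PairIn-outside : ∀ r → PairIn bar x i N r → Compatible (w , w′) r → ¬ (lo (proj₁ r) < lo w′)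
                   → PairIn bar x (i + L + m + L) N r
    PairIn-outside (r , r′) (i<l , l≤h , h<l′ , l≤h′ᵣ , h′≤ , eq) ((_ , (d , _)) , _) l≮l′ =
      after-w′ d , l≤h , h<l′ , l≤h′ᵣ , h′≤ , eq
      where
      after-w′ : Disjoint w′ r → i + L + m + L < lo r
      after-w′ (inj₁ h′<l) = subst (_< lo r) hi-w′ h′<l
      after-w′ (inj₂ h<l′) = ⊥-elim (<-irrefl refl (<-≤-trans h<l′ (≤-trans (≮⇒≥ l≮l′) l≤h)))

  PairIn-suc : ∀ i N r → lo (proj₁ r) ≢ suc i → PairIn bar x i N r → PairIn bar x (suc i) N r
  PairIn-suc i N r l≢ (i<l , rest) = ≤∧≢⇒< i<l (λ e → l≢ (sym e)) , rest

  LowerBoundAt : ℕ → Set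
  LowerBoundAt n = ∀ i S → i + n ≤ length x → AlignmentIn bar x i (i + n) S
                 → coveredSize S ≤ n × ThirdD≤ i (i + n) (costOver (8 * s) n S)

  lower-zero : LowerBoundAt 0
  lower-zero i []      _ _ = z≤n , subst (ThirdD≤ i (i + 0)) (sym (*-zeroʳ (8 * s))) (ThirdD≤-length i 0)
  lower-zero i (_ ∷ _) _ ((i<l , l≤h , h<l′ , l≤h′ , h′≤ , _) ∷ _ , _) =
    ⊥-elim (<-irrefl refl (<-≤-trans i<l (≤-trans l≤h (≤-trans (<⇒≤ h<l′) (≤-trans l≤h′ (subst (_ ≤_) (+-identityʳ i) h′≤))))))

  lower-unmatched : ∀ n → LowerBoundAt n → ∀ i S → i + suc n ≤ length x → AlignmentIn bar x i (i + suc n) S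
                  → All (λ p → lo (proj₁ p) ≢ suc i) S → coveredSize S ≤ suc n × ThirdD≤ i (i + suc n) (costOver (8 * s) (suc n) S)
  lower-unmatched n lower i S i+n≤ (pairs , compatible) none =
    ≤-trans (proj₁ rest) (n≤1+n n) ,
    subst₂ (ThirdD≤ i) (sym (+-suc i n)) (sym (cong (_+ 8 * s * length S) (+-∸-assoc 1 (proj₁ rest))))
      (ThirdD≤-concat {c₁ = 1} (n≤1+n i) (m≤m+n (suc i) n) (ThirdD≤-suc i) (proj₂ rest))
    where
    rest = lower (suc i) S (subst (_≤ length x) (+-suc i n) i+n≤)
             (All.zipWith (λ (l≢ , pr) → PairIn-suc i (suc i + n) _ l≢ pr) (none , subst (λ z → All (PairIn bar x i z) S) (+-suc i n) pairs) ,
              compatible)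

  -- The pair (w , w′) starting at i + 1 splits the remaining pairs into those nested inside it and those after it.
  module Matched (n i : ℕ) (S₁ : List Pair) (w w′ : Window) (S₂ : List Pair) (l≡ : lo w ≡ suc i) (i+n≤ : i + suc n ≤ length x)
                 (valid : AlignmentIn bar x i (i + suc n) (S₁ ++ (w , w′) ∷ S₂)) where

    q-in : PairIn bar x i (i + suc n) (w , w′)
    q-in = proj₁ (All-remove S₁ (proj₁ valid))

    others : List Pair
    others = S₁ ++ S₂

    shape = pairShape i (i + suc n) w w′ l≡ i+n≤ q-in
    open PairShape shape public

    e = i + L + m + L

    e≤ : e ≤ i + suc n
    e≤ = subst (_≤ i + suc n) hi-w′ (proj₁ (proj₂ (proj₂ (proj₂ (proj₂ q-in)))))

    n₂ = i + suc n ∸ e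

    e+n₂≡ : e + n₂ ≡ i + suc n
    e+n₂≡ = m+[n∸m]≡n e≤

    suc-n≡ : suc n ≡ L + m + L + n₂
    suc-n≡ = +-cancelˡ-≡ i _ _ (trans (sym e+n₂≡) (r i L m n₂))
      where
      r : ∀ i L m n₂ → i + L + m + L + n₂ ≡ i + (L + m + L + n₂)
      r = solve-∀

    m<suc-n : m < suc n
    m<suc-n = subst (m <_) (sym suc-n≡) (≤-trans (+-monoˡ-≤ m 1≤L) (≤-trans (m≤m+n (L + m) L) (m≤m+n _ n₂)))

    n₂<suc-n : n₂ < suc n
    n₂<suc-n = subst (n₂ <_) (sym suc-n≡) (+-monoˡ-≤ n₂ (≤-trans 1≤L (≤-trans (m≤m+n L m) (m≤m+n _ L))))

    Inside? : (r : Pair) → Dec (lo (proj₁ r) < lo w′)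
    Inside? r = lo (proj₁ r) <? lo w′

    Sᵢ Sₒ : List Pair
    Sᵢ = filter Inside? others
    Sₒ = filter (λ r → ¬? (Inside? r)) others

    others-valid : All (λ r → PairIn bar x i (i + suc n) r × Compatible (w , w′) r) others
    others-valid = All.zip (proj₂ (All-remove S₁ (proj₁ valid)) , proj₁ (AllPairs-remove S₁ (proj₂ valid)))
    l≤h′ : lo w′ ≤ hi w′
    l≤h′ = proj₁ (proj₂ (proj₂ (proj₂ q-in)))

    inside-valid : AlignmentIn bar x (i + L) (i + L + m) Sᵢ
    inside-valid =
      All.zipWith (λ ((pr , c) , l<) → PairIn-inside shape l≡ l≤h′ _ pr c l<) (All.filter⁺ Inside? others-valid , all-filter Inside? others) ,
      AllPairs.filter⁺ Inside? (proj₂ (AllPairs-remove S₁ (proj₂ valid)))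

    outside-valid : AlignmentIn bar x e (e + n₂) Sₒ
    outside-valid =
      subst (λ z → All (PairIn bar x e z) Sₒ) (sym e+n₂≡)
        (All.zipWith (λ ((pr , c) , l≮) → PairIn-outside shape l≡ l≤h′ _ pr c l≮)
                     (All.filter⁺ (λ r → ¬? (Inside? r)) others-valid , all-filter (λ r → ¬? (Inside? r)) others)) ,
      AllPairs.filter⁺ (λ r → ¬? (Inside? r)) (proj₂ (AllPairs-remove S₁ (proj₂ valid)))

    covered≡ : coveredSize (S₁ ++ (w , w′) ∷ S₂) ≡ L + (L + (coveredSize Sᵢ + coveredSize Sₒ))
    covered≡ = trans (coveredSize-++ S₁ ((w , w′) ∷ S₂))
      (trans (r (coveredSize S₁) (size w) (size w′) (coveredSize S₂))
        (cong₂ _+_ size-w (cong₂ _+_ size-w′ (trans (sym (coveredSize-++ S₁ S₂)) (coveredSize-filter Inside? others)))))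
      where
      r : ∀ a b c d → a + (b + (c + d)) ≡ b + (c + (a + d))
      r = solve-∀

    length≡ : length (S₁ ++ (w , w′) ∷ S₂) ≡ suc (length Sᵢ + length Sₒ)
    length≡ = trans (length-++ S₁) (trans (+-suc (length S₁) (length S₂))
                (cong suc (trans (sym (length-++ S₁)) (length-filter-split Inside? others))))

  lower-matched : ∀ n → (∀ {k} → k < suc n → LowerBoundAt k) → ∀ i S₁ w w′ S₂ → lo w ≡ suc i → i + suc n ≤ length x
                → AlignmentIn bar x i (i + suc n) (S₁ ++ (w , w′) ∷ S₂)
                → coveredSize (S₁ ++ (w , w′) ∷ S₂) ≤ suc n × ThirdD≤ i (i + suc n) (costOver (8 * s) (suc n) (S₁ ++ (w , w′) ∷ S₂))
  lower-matched n lower i S₁ w w′ S₂ l≡ i+n≤ valid =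
    covered≤ , subst₂ (ThirdD≤ i) e+n₂≡ cost≡
                 (ThirdD≤-concat {c₁ = 8 * s + costOver (8 * s) m Sᵢ} i≤e (m≤m+n e n₂)
                   (ThirdD≤-pair i L m _ (≤-trans e≤ i+n≤) mirror (proj₂ inside)) (proj₂ outside))
    where
    open Matched n i S₁ w w′ S₂ l≡ i+n≤ valid
    i≤e : i ≤ e
    i≤e = ≤-trans (m≤m+n i L) (≤-trans (m≤m+n _ m) (m≤m+n _ L))
    inside = lower m<suc-n (i + L) Sᵢ (≤-trans (m≤m+n _ L) (≤-trans e≤ i+n≤)) inside-valid
    outside = lower n₂<suc-n e Sₒ (subst (_≤ length x) (sym e+n₂≡) i+n≤) outside-valid
    covered≤ : coveredSize (S₁ ++ (w , w′) ∷ S₂) ≤ suc n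
    covered≤ = subst₂ _≤_ (sym covered≡) (sym suc-n≡)
      (≤-trans (+-monoʳ-≤ L (+-monoʳ-≤ L (+-mono-≤ (proj₁ inside) (proj₁ outside)))) (≤-reflexive (r L m n₂)))
      where
      r : ∀ L m n₂ → L + (L + (m + n₂)) ≡ L + m + L + n₂
      r = solve-∀
    cost≡ : 8 * s + costOver (8 * s) m Sᵢ + costOver (8 * s) n₂ Sₒ ≡ costOver (8 * s) (suc n) (S₁ ++ (w , w′) ∷ S₂)
    cost≡ = begin
      8 * s + costOver (8 * s) m Sᵢ + costOver (8 * s) n₂ Sₒ
        ≡⟨ costOver-pair (8 * s) L m n₂ Sᵢ Sₒ (proj₁ inside) (proj₁ outside) ⟩
      (L + m + L + n₂) ∸ (L + (L + (coveredSize Sᵢ + coveredSize Sₒ))) + 8 * s * suc (length Sᵢ + length Sₒ)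
        ≡⟨ cong₂ (λ N c → N ∸ c + 8 * s * suc (length Sᵢ + length Sₒ)) suc-n≡ covered≡ ⟨
      suc n ∸ coveredSize (S₁ ++ (w , w′) ∷ S₂) + 8 * s * suc (length Sᵢ + length Sₒ)
        ≡⟨ cong (λ l → suc n ∸ coveredSize (S₁ ++ (w , w′) ∷ S₂) + 8 * s * l) length≡ ⟨
      costOver (8 * s) (suc n) (S₁ ++ (w , w′) ∷ S₂)
        ∎
      where open ≡-Reasoning

  alignment-lower : ∀ n → LowerBoundAt n
  alignment-lower = <-rec LowerBoundAt step
    where
    step : ∀ n → (∀ {k} → k < n → LowerBoundAt k) → LowerBoundAt n
    step zero    _     = lower-zero
    step (suc n) lower i S i+n≤ valid with find-starting-at (suc i) S
    ... | inj₂ none                               = lower-unmatched n (lower ≤-refl) i S i+n≤ valid none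
    ... | inj₁ (S₁ , (w , w′) , S₂ , refl , l≡) = lower-matched n lower i S₁ w w′ S₂ l≡ i+n≤ valid

-- The upper bound

[m+n]∸[o+p]≤[m∸o]+[n∸p] : ∀ m n o p → (m + n) ∸ (o + p) ≤ (m ∸ o) + (n ∸ p)
[m+n]∸[o+p]≤[m∸o]+[n∸p] m n o p = begin
  (m + n) ∸ (o + p)                         ≤⟨ ∸-monoˡ-≤ (o + p) (+-mono-≤ (m≤n+m∸n m o) (m≤n+m∸n n p)) ⟩
  (o + (m ∸ o)) + (p + (n ∸ p)) ∸ (o + p)   ≡⟨ cong (_∸ (o + p)) (r o (m ∸ o) p (n ∸ p)) ⟩
  (o + p) + ((m ∸ o) + (n ∸ p)) ∸ (o + p)   ≡⟨ m+n∸m≡n (o + p) _ ⟩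
  (m ∸ o) + (n ∸ p)                         ∎
  where
  open ≤-Reasoning
  r : ∀ a b c d → (a + b) + (c + d) ≡ (a + c) + (b + d)
  r = solve-∀

costOver-++ : ∀ ρ m n S T → costOver ρ (m + n) (S ++ T) ≤ costOver ρ m S + costOver ρ n T
costOver-++ ρ m n S T = begin
  (m + n) ∸ coveredSize (S ++ T) + ρ * length (S ++ T)
    ≡⟨ cong₂ (λ c l → (m + n) ∸ c + ρ * l) (coveredSize-++ S T) (length-++ S) ⟩
  (m + n) ∸ (coveredSize S + coveredSize T) + ρ * (length S + length T)
    ≤⟨ +-monoˡ-≤ (ρ * (length S + length T)) ([m+n]∸[o+p]≤[m∸o]+[n∸p] m n (coveredSize S) (coveredSize T)) ⟩
  (m ∸ coveredSize S) + (n ∸ coveredSize T) + ρ * (length S + length T)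
    ≡⟨ r (m ∸ coveredSize S) (n ∸ coveredSize T) ρ (length S) (length T) ⟩
  costOver ρ m S + costOver ρ n T
    ∎
  where
  open ≤-Reasoning
  r : ∀ a b ρ l₁ l₂ → a + b + ρ * (l₁ + l₂) ≡ (a + ρ * l₁) + (b + ρ * l₂)
  r = solve-∀

module Upper {A : Set} (_≟_ : DecidableEquality A) (bar : A → A) (bar-inv : ∀ a → bar (bar a) ≡ a) (x : List A) (s : ℕ) .{{_ : NonZero s}} where

  open Table _≟_ bar x s

  cost : ℕ → ℕ → List Pair → ℕ
  cost i j = costOver (8 * s) (j ∸ i)

  Achieves : ℕ → ℕ → ℕ → Set
  Achieves i j D′ = Σ (List Pair) λ S → AlignmentIn bar x i j S × cost i j S + i % s ≤ D′ + j % s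

  PairIn-widen : ∀ {l r l′ r′} p → l′ ≤ l → r ≤ r′ → PairIn bar x l r p → PairIn bar x l′ r′ p
  PairIn-widen p l′≤l r≤r′ (l<lo , l≤h , h<l′ , l≤h′ , h′≤r , eq) = ≤-<-trans l′≤l l<lo , l≤h , h<l′ , l≤h′ , ≤-trans h′≤r r≤r′ , eq

  PairIn-successive : ∀ {i k j} p p′ → PairIn bar x i k p → PairIn bar x k j p′ → Compatible p p′
  PairIn-successive (r , r′) (q , q′) (_ , l≤h , h<l′ , l≤h′ , h′≤k , _) (k<l , lq≤hq , hq<lq′ , _) =
    ((inj₁ h<lq , inj₁ (<-trans h<lq (≤-<-trans lq≤hq hq<lq′))) ,
     (inj₁ h′<lq , inj₁ (<-trans h′<lq (≤-<-trans lq≤hq hq<lq′)))) ,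
    inj₁ (≤-<-trans l≤h′ h′<lq , ≤-<-trans lq≤hq hq<lq′)
    where
    h′<lq : hi r′ < lo q
    h′<lq = ≤-<-trans h′≤k k<l
    h<lq : hi r < lo q
    h<lq = <-trans h<l′ (≤-<-trans l≤h′ h′<lq)

  alignmentIn-++ : ∀ {i k j} S T → i ≤ k → k ≤ j → AlignmentIn bar x i k S → AlignmentIn bar x k j T → AlignmentIn bar x i j (S ++ T)
  alignmentIn-++ S T i≤k k≤j (pairsS , compatibleS) (pairsT , compatibleT) =
    All.++⁺ (All.map (PairIn-widen _ ≤-refl k≤j) pairsS) (All.map (PairIn-widen _ i≤k ≤-refl) pairsT) ,
    AllPairs.++⁺ compatibleS compatibleT (All.map (λ prS → All.map (PairIn-successive _ _ prS) pairsT) pairsS)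

  -- The occurrence of bar(x(Q..Q+ds]) inside x(as..P], cut so as to start after i, is paired with a prefix of x(Q..Q+ds].
  module MirrorPair (i j A′ J a d k₂ : ℕ) (S′ : List Pair)
                    (i≡ : i ≡ A′ + a * s) (A′<s : A′ < s) (1≤d : 1 ≤ d) (j≤ : j ≤ length x)
                    (j≡ : j ≡ J + ((a + d + 2 + k₂) * s + d * s))
                    (occurs : Infix _≡_ (barStr bar (seg x ((a + d + 2 + k₂) * s) (d * s))) (seg x (a * s) ((2 + d) * s)))
                    (inner : AlignmentIn bar x ((a + d + 2) * s) ((a + d + 2 + k₂) * s) S′) where

    P = (a + d + 2) * s
    Q = (a + d + 2 + k₂) * s
    ds = d * s

    P≡ : P ≡ a * s + (2 + d) * s
    P≡ = r a d s
      where
      r : ∀ a d s → (a + d + 2) * s ≡ a * s + (2 + d) * s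
      r = solve-∀

    P≤Q : P ≤ Q
    P≤Q = *-monoˡ-≤ s (m≤m+n (a + d + 2) k₂)

    Q+ds≤j : Q + ds ≤ j
    Q+ds≤j = subst (Q + ds ≤_) (sym j≡) (m≤n+m _ J)

    Q≤j : Q ≤ j
    Q≤j = ≤-trans (m≤m+n Q ds) Q+ds≤j

    i≤P : i ≤ P
    i≤P = subst₂ _≤_ (sym i≡) (sym P≡)
      (≤-trans (≤-reflexive (+-comm A′ (a * s))) (+-monoʳ-≤ (a * s) (≤-trans (<⇒≤ A′<s) (m≤m+n s (s + d * s)))))

    offset = infix⇒seg occurs
    o = proj₁ offset

    length-image : length (barStr bar (seg x Q ds)) ≡ ds
    length-image = trans (length-barStr bar (seg x Q ds)) (length-seg x Q ds (≤-trans Q+ds≤j j≤))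

    o+ds≤ : o + ds ≤ (2 + d) * s
    o+ds≤ = subst₂ (λ n l → o + n ≤ l) length-image
      (length-seg x (a * s) ((2 + d) * s) (subst (_≤ length x) P≡ (≤-trans P≤Q (≤-trans Q≤j j≤))))
      (proj₁ (proj₂ offset))

    pos = a * s + o

    image≡ : barStr bar (seg x Q ds) ≡ seg x pos ds
    image≡ = trans (proj₂ (proj₂ offset))
                   (trans (cong (seg (seg x (a * s) ((2 + d) * s)) o) length-image) (seg-seg x (a * s) ((2 + d) * s) o ds o+ds≤))

    pos+ds≤P : pos + ds ≤ P
    pos+ds≤P = subst (pos + ds ≤_) (sym P≡)
      (subst (_≤ a * s + (2 + d) * s) (sym (+-assoc (a * s) o ds)) (+-monoʳ-≤ (a * s) o+ds≤))

    cut = i ∸ pos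
    n′ = ds ∸ cut

    cut≤A′ : cut ≤ A′
    cut≤A′ = subst (cut ≤_) (trans (cong (_∸ a * s) i≡) (m+n∸n≡m A′ (a * s))) (∸-monoʳ-≤ i (m≤m+n (a * s) o))

    cut<ds : cut < ds
    cut<ds = <-≤-trans (≤-<-trans cut≤A′ A′<s) (subst (_≤ ds) (*-identityˡ s) (*-monoˡ-≤ s 1≤d))

    ds≡ : ds ≡ cut + n′
    ds≡ = sym (m+[n∸m]≡n (<⇒≤ cut<ds))

    1≤n′ : 1 ≤ n′
    1≤n′ = m<n⇒0<n∸m cut<ds

    w w′ : Window
    w  = ⟦ suc (pos + cut) , pos + cut + n′ ⟧
    w′ = ⟦ suc Q , Q + n′ ⟧

    w′-mirrors-w : window x w′ ≡ barStr bar (window x w)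
    w′-mirrors-w = begin
      sub x Q (Q + n′)                          ≡⟨ sub≡seg x Q n′ ⟩
      seg x Q n′                                ≡⟨ cong (λ z → seg x z n′) (+-identityʳ Q) ⟨
      seg x (Q + 0) n′                          ≡⟨ seg-seg x Q ds 0 n′ (subst (n′ ≤_) (sym ds≡) (m≤n+m n′ cut)) ⟨
      seg (seg x Q ds) 0 n′                     ≡⟨ cong (λ z → seg z 0 n′) (trans (sym (barStr-involutive bar bar-inv (seg x Q ds))) (cong (barStr bar) image≡)) ⟩
      seg (barStr bar (seg x pos ds)) 0 n′    ≡⟨ barStr-seg bar (seg x pos ds) cut n′ 0 length-occurrence ⟨
      barStr bar (seg (seg x pos ds) cut n′)  ≡⟨ cong (barStr bar) (seg-seg x pos ds cut n′ (≤-reflexive (sym ds≡))) ⟩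
      barStr bar (seg x (pos + cut) n′)       ≡⟨ cong (barStr bar) (sub≡seg x (pos + cut) n′) ⟨
      barStr bar (sub x (pos + cut) (pos + cut + n′)) ∎
      where
      open ≡-Reasoning
      length-occurrence : length (seg x pos ds) ≡ cut + n′ + 0
      length-occurrence = trans (length-seg x pos ds (≤-trans pos+ds≤P (≤-trans P≤Q (≤-trans Q≤j j≤))))
                                (trans ds≡ (sym (+-identityʳ _)))

    hi-w≡ : pos + cut + n′ ≡ pos + ds
    hi-w≡ = trans (+-assoc pos cut n′) (cong (pos +_) (sym ds≡))

    lo≤hi : ∀ l → suc l ≤ l + n′
    lo≤hi l = subst (_≤ l + n′) (+-comm l 1) (+-monoʳ-≤ l 1≤n′)

    pair-in : PairIn bar x i j (w , w′)
    pair-in = s≤s (m≤n+m∸n i pos) , lo≤hi (pos + cut) ,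
              s≤s (subst (_≤ Q) (sym hi-w≡) (≤-trans pos+ds≤P P≤Q)) , lo≤hi Q ,
              ≤-trans (+-monoʳ-≤ Q (m∸n≤m ds cut)) Q+ds≤j , w′-mirrors-w

    pair-compatible : ∀ r → PairIn bar x P Q r → Compatible (w , w′) r
    pair-compatible (r , r′) (P<l , l≤h , h<l′ , l≤h′ , h′≤Q , _) =
      ((inj₁ w<r , inj₁ (<-trans w<r (≤-<-trans l≤h h<l′))) , (inj₂ (<-trans h<l′ (≤-<-trans l≤h′ r′<w′)) , inj₂ r′<w′)) ,
      inj₂ (inj₁ (≤-<-trans (≤-trans (lo≤hi (pos + cut)) (≤-reflexive hi-w≡)) (≤-<-trans pos+ds≤P P<l) ,
                  ≤-<-trans l≤h h<l′ , ≤-<-trans l≤h′ r′<w′))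
      where
      w<r : pos + cut + n′ < lo r
      w<r = subst (_< lo r) (sym hi-w≡) (≤-<-trans pos+ds≤P P<l)
      r′<w′ : hi r′ < suc Q
      r′<w′ = s≤s h′≤Q

    S = (w , w′) ∷ S′

    alignment : AlignmentIn bar x i j S
    alignment = pair-in ∷ All.map (PairIn-widen _ i≤P Q≤j) (proj₁ inner) ,
                All.map (pair-compatible _) (proj₁ inner) ∷ proj₂ inner

    j∸i≡ : j ∸ i ≡ (P ∸ i) + (j ∸ Q) + (Q ∸ P)
    j∸i≡ = +-cancelˡ-≡ i _ _ (begin
      i + (j ∸ i)                                   ≡⟨ m+[n∸m]≡n (≤-trans i≤P (≤-trans P≤Q Q≤j)) ⟩
      j                                             ≡⟨ m+[n∸m]≡n Q≤j ⟨
      Q + (j ∸ Q)                                   ≡⟨ cong (_+ (j ∸ Q)) (m+[n∸m]≡n P≤Q) ⟨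
      P + (Q ∸ P) + (j ∸ Q)                         ≡⟨ cong (λ z → z + (Q ∸ P) + (j ∸ Q)) (m+[n∸m]≡n i≤P) ⟨
      i + (P ∸ i) + (Q ∸ P) + (j ∸ Q)               ≡⟨ r i (P ∸ i) (Q ∸ P) (j ∸ Q) ⟩
      i + ((P ∸ i) + (j ∸ Q) + (Q ∸ P))             ∎)
      where
      open ≡-Reasoning
      r : ∀ i a b c → i + a + b + c ≡ i + ((a + c) + b)
      r = solve-∀

    A′≤2s : A′ ≤ 2 * s
    A′≤2s = ≤-trans (<⇒≤ A′<s) (m≤m+n s (s + 0))

    P∸i≡ : P ∸ i ≡ (2 * s ∸ A′) + cut + n′
    P∸i≡ = trans (cong (P ∸_) i≡) (trans (cong (_∸ (A′ + a * s)) P≡′) (m+n∸m≡n (A′ + a * s) _))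
      where
      open ≡-Reasoning
      r : ∀ a d s → a * s + (2 + d) * s ≡ a * s + 2 * s + d * s
      r = solve-∀
      r′ : ∀ as A′ z cut n′ → as + (A′ + z) + (cut + n′) ≡ A′ + as + (z + cut + n′)
      r′ = solve-∀
      P≡′ : P ≡ A′ + a * s + ((2 * s ∸ A′) + cut + n′)
      P≡′ = begin
        P                                          ≡⟨ P≡ ⟩
        a * s + (2 + d) * s                        ≡⟨ r a d s ⟩
        a * s + 2 * s + ds                         ≡⟨ cong (λ z → a * s + z + ds) (m+[n∸m]≡n A′≤2s) ⟨
        a * s + (A′ + (2 * s ∸ A′)) + ds           ≡⟨ cong (a * s + (A′ + (2 * s ∸ A′)) +_) ds≡ ⟩
        a * s + (A′ + (2 * s ∸ A′)) + (cut + n′)   ≡⟨ r′ (a * s) A′ (2 * s ∸ A′) cut n′ ⟩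
        A′ + a * s + ((2 * s ∸ A′) + cut + n′)     ∎

    j∸Q≡ : j ∸ Q ≡ J + cut + n′
    j∸Q≡ = trans (cong (_∸ Q) (trans j≡ (trans (cong (λ z → J + (Q + z)) ds≡) (r J Q cut n′)))) (m+n∸m≡n Q _)
      where
      r : ∀ J Q c n → J + (Q + (c + n)) ≡ Q + (J + c + n)
      r = solve-∀

    cost-bound : cost i j S + A′ ≤ 12 * s + cost P Q S′ + J
    cost-bound = begin
      (j ∸ i) ∸ (size w + (size w′ + coveredSize S′)) + 8 * s * suc (length S′) + A′
        ≡⟨ cong₂ (λ N c → N ∸ c + 8 * s * suc (length S′) + A′) (trans j∸i≡ (cong (_+ Y) X≡))
                 (cong₂ (λ a b → a + (b + coveredSize S′)) (size-after (pos + cut) n′ 1≤n′) (size-after Q n′ 1≤n′)) ⟩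
      ((n′ + n′) + R + Y) ∸ (n′ + (n′ + coveredSize S′)) + 8 * s * suc (length S′) + A′
        ≡⟨ cong (λ z → z + 8 * s * suc (length S′) + A′)
             (trans (cong₂ _∸_ (+-assoc (n′ + n′) R Y) (sym (+-assoc n′ n′ (coveredSize S′)))) ([m+n]∸[m+o]≡n∸o (n′ + n′) (R + Y) (coveredSize S′))) ⟩
      (R + Y) ∸ (0 + coveredSize S′) + 8 * s * suc (length S′) + A′
        ≤⟨ +-monoˡ-≤ A′ (+-monoˡ-≤ (8 * s * suc (length S′)) ([m+n]∸[o+p]≤[m∸o]+[n∸p] R Y 0 (coveredSize S′))) ⟩
      R + (Y ∸ coveredSize S′) + 8 * s * suc (length S′) + A′
        ≡⟨ r₁ R (Y ∸ coveredSize S′) s (length S′) A′ ⟩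
      (R + A′) + (Y ∸ coveredSize S′) + 8 * s + 8 * s * length S′
        ≡⟨ cong (λ z → z + (Y ∸ coveredSize S′) + 8 * s + 8 * s * length S′) R+A′≡ ⟩
      2 * s + J + 2 * cut + (Y ∸ coveredSize S′) + 8 * s + 8 * s * length S′
        ≤⟨ +-monoˡ-≤ (8 * s * length S′) (+-monoˡ-≤ (8 * s) (+-monoˡ-≤ (Y ∸ coveredSize S′)
             (+-monoʳ-≤ (2 * s + J) (*-monoʳ-≤ 2 (≤-trans cut≤A′ (<⇒≤ A′<s)))))) ⟩
      2 * s + J + 2 * s + (Y ∸ coveredSize S′) + 8 * s + 8 * s * length S′
        ≡⟨ r₂ s J (Y ∸ coveredSize S′) (length S′) ⟩
      12 * s + cost P Q S′ + J
        ∎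
      where
      open ≤-Reasoning
      Y = Q ∸ P
      R = (2 * s ∸ A′) + cut + J + cut
      X≡ : (P ∸ i) + (j ∸ Q) ≡ (n′ + n′) + R
      X≡ = trans (cong₂ _+_ P∸i≡ j∸Q≡) (r (2 * s ∸ A′) cut n′ J)
        where
        r : ∀ z c n J → z + c + n + (J + c + n) ≡ (n + n) + (z + c + J + c)
        r = solve-∀
      R+A′≡ : R + A′ ≡ 2 * s + J + 2 * cut
      R+A′≡ = trans (r (2 * s ∸ A′) cut J A′) (cong (λ z → z + J + 2 * cut) (m∸n+n≡m A′≤2s))
        where
        r : ∀ z c J A′ → z + c + J + c + A′ ≡ z + A′ + J + 2 * c
        r = solve-∀
      r₁ : ∀ R Z s l A′ → R + Z + 8 * s * suc l + A′ ≡ (R + A′) + Z + 8 * s + 8 * s * l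
      r₁ = solve-∀
      r₂ : ∀ s J Z l → 2 * s + J + 2 * s + Z + 8 * s + 8 * s * l ≡ 12 * s + (Z + 8 * s * l) + J
      r₂ = solve-∀

  cost-[] : ∀ i j a ℓ → i ≤ j → i ≡ i % s + a * s → j ≡ j % s + (a + ℓ) * s → cost i j [] + i % s ≡ j % s + ℓ * s
  cost-[] i j a ℓ i≤j i≡ j≡ = +-cancelʳ-≡ i _ _ (begin
    (j ∸ i) + 8 * s * 0 + i % s + i   ≡⟨ cong (λ z → (j ∸ i) + z + i % s + i) (*-zeroʳ (8 * s)) ⟩
    (j ∸ i) + 0 + i % s + i           ≡⟨ r (j ∸ i) (i % s) i ⟩
    (j ∸ i + i) + i % s               ≡⟨ cong (_+ i % s) (m∸n+n≡m i≤j) ⟩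
    j + i % s                         ≡⟨ cong (_+ i % s) j≡ ⟩
    j % s + (a + ℓ) * s + i % s       ≡⟨ r′ (j % s) a ℓ s (i % s) ⟩
    j % s + ℓ * s + (i % s + a * s)   ≡⟨ cong (j % s + ℓ * s +_) i≡ ⟨
    j % s + ℓ * s + i                 ∎)
    where
    open ≡-Reasoning
    r : ∀ n A i → n + 0 + A + i ≡ (n + i) + A
    r = solve-∀
    r′ : ∀ J a ℓ s A → J + (a + ℓ) * s + A ≡ J + ℓ * s + (A + a * s)
    r′ = solve-∀

  achieves-[] : ∀ i j a ℓ → i ≤ j → i / s ≡ a → j / s ≡ a + ℓ → ℓ * s ≤ D[ a , a + ℓ ] → Achieves i j D[ a , a + ℓ ]
  achieves-[] i j a ℓ i≤j i/s≡ j/s≡ ℓs≤D = [] , ([] , []) ,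
    subst (_≤ D[ a , a + ℓ ] + j % s) (sym (cost-[] i j a ℓ i≤j i≡ j≡)) (subst (_≤ D[ a , a + ℓ ] + j % s) (+-comm (ℓ * s) (j % s)) (+-monoˡ-≤ (j % s) ℓs≤D))
    where
    i≡ : i ≡ i % s + a * s
    i≡ = trans (m≡m%n+[m/n]*n i s) (cong (λ z → i % s + z * s) i/s≡)
    j≡ : j ≡ j % s + (a + ℓ) * s
    j≡ = trans (m≡m%n+[m/n]*n j s) (cong (λ z → j % s + z * s) j/s≡)

  achieves-++ : ∀ {i k j D₁ D₂} → i ≤ k → k ≤ j → k % s ≡ 0 → Achieves i k D₁ → Achieves k j D₂ → Achieves i j (D₁ + D₂)
  achieves-++ {i} {k} {j} {D₁} {D₂} i≤k k≤j k%s≡0 (S₁ , valid₁ , bound₁) (S₂ , valid₂ , bound₂) =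
    S₁ ++ S₂ , alignmentIn-++ S₁ S₂ i≤k k≤j valid₁ valid₂ , (begin
      cost i j (S₁ ++ S₂) + i % s                     ≤⟨ +-monoˡ-≤ (i % s) cost-++ ⟩
      cost i k S₁ + cost k j S₂ + i % s               ≡⟨ r (cost i k S₁) (cost k j S₂) (i % s) ⟩
      (cost i k S₁ + i % s) + (cost k j S₂ + 0)       ≡⟨ cong (λ z → (cost i k S₁ + i % s) + (cost k j S₂ + z)) k%s≡0 ⟨
      (cost i k S₁ + i % s) + (cost k j S₂ + k % s)   ≤⟨ +-mono-≤ bound₁ bound₂ ⟩
      (D₁ + k % s) + (D₂ + j % s)                     ≡⟨ cong (λ z → (D₁ + z) + (D₂ + j % s)) k%s≡0 ⟩
      (D₁ + 0) + (D₂ + j % s)                         ≡⟨ r′ D₁ D₂ (j % s) ⟩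
      D₁ + D₂ + j % s                                 ∎)
    where
    open ≤-Reasoning
    j∸i≡ : (k ∸ i) + (j ∸ k) ≡ j ∸ i
    j∸i≡ = +-cancelˡ-≡ i _ _ (trans (sym (+-assoc i (k ∸ i) (j ∸ k)))
             (trans (cong (_+ (j ∸ k)) (m+[n∸m]≡n i≤k)) (trans (m+[n∸m]≡n k≤j) (sym (m+[n∸m]≡n (≤-trans i≤k k≤j))))))
    cost-++ : cost i j (S₁ ++ S₂) ≤ cost i k S₁ + cost k j S₂
    cost-++ = subst (λ n → costOver (8 * s) n (S₁ ++ S₂) ≤ cost i k S₁ + cost k j S₂) j∸i≡ (costOver-++ (8 * s) (k ∸ i) (j ∸ k) S₁ S₂)
    r : ∀ X Y A → X + Y + A ≡ (X + A) + (Y + 0)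
    r = solve-∀
    r′ : ∀ X Y J → (X + 0) + (Y + J) ≡ (X + Y) + J
    r′ = solve-∀

  achieves-mirror : ∀ {i j D′} a d k₂ → 1 ≤ d → j ≤ length x → i / s ≡ a → j / s ≡ a + d + 2 + k₂ + d
                  → Infix _≡_ (barStr bar (seg x ((a + d + 2 + k₂) * s) (d * s))) (seg x (a * s) ((2 + d) * s))
                  → Achieves ((a + d + 2) * s) ((a + d + 2 + k₂) * s) D′ → Achieves i j (12 * s + D′)
  achieves-mirror {i} {j} {D′} a d k₂ 1≤d j≤ i/s≡ j/s≡ occurs (S′ , valid′ , bound′) =
    M.S , M.alignment , ≤-trans M.cost-bound (+-monoˡ-≤ (j % s) (+-monoʳ-≤ (12 * s) inner-cost))
    where
    P = (a + d + 2) * s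
    Q = (a + d + 2 + k₂) * s
    i≡ : i ≡ i % s + a * s
    i≡ = trans (m≡m%n+[m/n]*n i s) (cong (λ z → i % s + z * s) i/s≡)
    j≡ : j ≡ j % s + (Q + d * s)
    j≡ = trans (m≡m%n+[m/n]*n j s) (trans (cong (λ z → j % s + z * s) j/s≡) (cong (j % s +_) (*-distribʳ-+ s (a + d + 2 + k₂) d)))
    module M = MirrorPair i j (i % s) (j % s) a d k₂ S′ i≡ (m%n<n i s) 1≤d j≤ j≡ occurs valid′
    inner-cost : cost P Q S′ ≤ D′
    inner-cost = subst₂ _≤_ (+-identityʳ _) (+-identityʳ _)
      (subst₂ (λ r r′ → cost P Q S′ + r ≤ D′ + r′) (proj₂ (divMod-* s (a + d + 2))) (proj₂ (divMod-* s (a + d + 2 + k₂))) bound′)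

  alignment-upper : ∀ fuel a ℓ i j → ℓ < fuel → i / s ≡ a → j / s ≡ a + ℓ → i ≤ j → j ≤ length x → Achieves i j D[ a , a + ℓ ]
  alignment-upper (suc fuel) a zero          i j _ i/s≡ j/s≡ i≤j _ = achieves-[] i j a 0 i≤j i/s≡ j/s≡ z≤n
  alignment-upper (suc fuel) a (suc zero)    i j _ i/s≡ j/s≡ i≤j _ =
    achieves-[] i j a 1 i≤j i/s≡ j/s≡ (≤-reflexive (trans (+-identityʳ s) (sym (D≡Dl a (a + 1) 1 (m+n∸m≡n a 1)))))
  alignment-upper (suc fuel) a (suc (suc k)) i j (s≤s ℓ<fuel) i/s≡ j/s≡ i≤j j≤ with D-attained a k
  ... | inj₁ (t , 1≤t , t≤ , D≡) =
    subst (Achieves i j) (sym D≡) (achieves-++ i≤mid mid≤j (proj₂ (divMod-* s (a + t))) left (subst (Achieves mid j) (cong D[ a + t ,_] a+t+[ℓ∸t]≡) right))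
    where
    ℓ = suc (suc k)
    mid = (a + t) * s
    i≤mid : i ≤ mid
    i≤mid = subst₂ _≤_ (sym (trans (m≡m%n+[m/n]*n i s) (cong (λ z → i % s + z * s) i/s≡))) (sym (*-distribʳ-+ s a t))
      (≤-trans (≤-reflexive (+-comm (i % s) (a * s)))
        (+-monoʳ-≤ (a * s) (≤-trans (<⇒≤ (m%n<n i s)) (subst (_≤ t * s) (*-identityˡ s) (*-monoˡ-≤ s 1≤t)))))
    mid≤j : mid ≤ j
    mid≤j = subst (mid ≤_) (sym (trans (m≡m%n+[m/n]*n j s) (cong (λ z → j % s + z * s) j/s≡)))
      (≤-trans (*-monoˡ-≤ s (+-monoʳ-≤ a (m≤n⇒m≤1+n t≤))) (m≤n+m _ (j % s)))
    a+t+[ℓ∸t]≡ : a + t + (ℓ ∸ t) ≡ a + ℓ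
    a+t+[ℓ∸t]≡ = trans (+-assoc a t (ℓ ∸ t)) (cong (a +_) (m+[n∸m]≡n (m≤n⇒m≤1+n t≤)))
    left = alignment-upper fuel a t i mid (≤-trans (s≤s t≤) ℓ<fuel) i/s≡ (proj₁ (divMod-* s (a + t))) i≤mid (≤-trans mid≤j j≤)
    right = alignment-upper fuel (a + t) (ℓ ∸ t) mid j (≤-trans (∸-monoʳ-< {m = ℓ} {n = t} {o = 0} 1≤t (m≤n⇒m≤1+n t≤)) ℓ<fuel)
              (proj₁ (divMod-* s (a + t))) (trans j/s≡ (sym a+t+[ℓ∸t]≡)) mid≤j j≤
  ... | inj₂ (d , 1≤d , 2d≤k , mirror , D≡) =
    subst (Achieves i j) (sym (trans D≡ (cong (λ b → 12 * s + D[ a + d + 2 , b ]) b∸d≡)))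
      (achieves-mirror a d k₂ 1≤d j≤ i/s≡ (trans j/s≡ b≡) occurs inner)
    where
    ℓ = suc (suc k)
    k₂ = k ∸ 2 * d
    b≡ : a + ℓ ≡ a + d + 2 + k₂ + d
    b≡ = trans (cong (λ z → a + suc (suc z)) (sym (m+[n∸m]≡n 2d≤k))) (r a d k₂)
      where
      r : ∀ a d k₂ → a + suc (suc (2 * d + k₂)) ≡ a + d + 2 + k₂ + d
      r = solve-∀
    b∸d≡ : a + ℓ ∸ d ≡ a + d + 2 + k₂
    b∸d≡ = sym (mirror-end a k d 2d≤k)
    Q+ds≡ : (a + ℓ) * s ≡ (a + d + 2 + k₂) * s + d * s
    Q+ds≡ = trans (cong (_* s) b≡) (*-distribʳ-+ s (a + d + 2 + k₂) d)
    Q+ds≤j : (a + d + 2 + k₂) * s + d * s ≤ j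
    Q+ds≤j = subst (_≤ j) Q+ds≡ (subst (_≤ j) (cong (_* s) j/s≡) (m/n*n≤m j s))
    occurs : Infix _≡_ (barStr bar (seg x ((a + d + 2 + k₂) * s) (d * s))) (seg x (a * s) ((2 + d) * s))
    occurs = subst₂ (λ u v → Infix _≡_ (barStr bar u) v) image≡ block≡ mirror
      where
      image≡ : sub x ((a + ℓ ∸ d) * s) ((a + ℓ) * s) ≡ seg x ((a + d + 2 + k₂) * s) (d * s)
      image≡ = trans (cong₂ (sub x) (cong (_* s) b∸d≡) Q+ds≡) (sub≡seg x ((a + d + 2 + k₂) * s) (d * s))
      block≡ : sub x (a * s) ((a + d + 2) * s) ≡ seg x (a * s) ((2 + d) * s)
      block≡ = trans (cong (sub x (a * s)) (r a d s)) (sub≡seg x (a * s) ((2 + d) * s))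
        where
        r : ∀ a d s → (a + d + 2) * s ≡ a * s + (2 + d) * s
        r = solve-∀
    inner = alignment-upper fuel (a + d + 2) k₂ ((a + d + 2) * s) ((a + d + 2 + k₂) * s)
              (≤-trans (s≤s (m∸n≤m k (2 * d))) (≤-trans (n≤1+n (suc k)) ℓ<fuel))
              (proj₁ (divMod-* s (a + d + 2))) (proj₁ (divMod-* s (a + d + 2 + k₂))) (*-monoˡ-≤ s (m≤m+n (a + d + 2) k₂))
              (≤-trans (≤-trans (m≤m+n _ (d * s)) Q+ds≤j) j≤)

module _ {A : Set} (_≟_ : DecidableEquality A) (bar : A → A) (bar-inv : ∀ a → bar (bar a) ≡ a)
         (x : List A) (s : ℕ) .{{_ : NonZero s}} (i j : ℕ) (i≤j : i ≤ j) (j≤ : j ≤ length x) where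

  open Table _≟_ bar x s
  open Shift bar x i j i≤j

  length-sub : length (sub x i j) ≡ j ∸ i
  length-sub = length-seg x i (j ∸ i) (subst (_≤ length x) (sym (m+[n∸m]≡n i≤j)) j≤)

  fold-lower : ∀ v → IsFold bar (8 * s) (sub x i j) v → D[ i / s , j / s ] + 3 * (j % s) ≤ 3 * (v + i % s)
  fold-lower v ((S , S-valid , S-cost) , _) =
    subst₂ (λ j′ c → D[ i / s , j′ / s ] + 3 * (j′ % s) ≤ 3 * (c + i % s)) (m+[n∸m]≡n i≤j) cost≡
      (proj₂ (Lower.alignment-lower _≟_ bar bar-inv x s (j ∸ i) i (map (mapPair shift) S)
                (subst (_≤ length x) (sym (m+[n∸m]≡n i≤j)) j≤)
                (subst (λ j′ → AlignmentIn bar x i j′ (map (mapPair shift) S)) (sym (m+[n∸m]≡n i≤j))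
                  (alignmentIn-shift S (subst (λ n → AlignmentIn bar (sub x i j) 0 n S) length-sub (windowAlignment⇒alignmentIn S S-valid))))))
    where
    cost≡ : costOver (8 * s) (j ∸ i) (map (mapPair shift) S) ≡ v
    cost≡ = trans (cong₂ (λ c l → j ∸ i ∸ c + 8 * s * l) (coveredSize-shift i S) (length-map _ S))
                  (trans (cong (λ n → costOver (8 * s) n S) (sym length-sub)) S-cost)

  fold-upper : ∀ v → IsFold bar (8 * s) (sub x i j) v → v + i % s ≤ D[ i / s , j / s ] + j % s
  fold-upper v (_ , minimal) =
    ≤-trans (+-monoˡ-≤ (i % s) (subst (v ≤_) cost≡ (minimal S S-valid)))
            (subst (λ b → Upper.cost _≟_ bar bar-inv x s i j T + i % s ≤ D[ i / s , b ] + j % s) (sym j/s≡) (proj₂ (proj₂ upper)))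
    where
    j/s≡ : j / s ≡ i / s + (j / s ∸ i / s)
    j/s≡ = sym (m+[n∸m]≡n (/-monoˡ-≤ s i≤j))
    upper = Upper.alignment-upper _≟_ bar bar-inv x s (suc (j / s ∸ i / s)) (i / s) (j / s ∸ i / s) i j ≤-refl refl j/s≡ i≤j j≤
    T = proj₁ upper
    T-valid = proj₁ (proj₂ upper)
    S = map (mapPair unshift) T
    shift-S≡ : map (mapPair shift) S ≡ T
    shift-S≡ = shift∘unshift T (proj₁ T-valid)
    S-valid : IsWindowAlignment bar (sub x i j) S
    S-valid = alignmentIn⇒windowAlignment S (subst (λ n → AlignmentIn bar (sub x i j) 0 n S) (sym length-sub)
                (alignmentIn-unshift S (subst (AlignmentIn bar x i j) (sym shift-S≡) T-valid)))
    cost≡ : foldCost (8 * s) (sub x i j) S ≡ Upper.cost _≟_ bar bar-inv x s i j T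
    cost≡ = begin
      costOver (8 * s) (length (sub x i j)) S                        ≡⟨ cong (λ n → costOver (8 * s) n S) length-sub ⟩
      costOver (8 * s) (j ∸ i) S                                     ≡⟨ cong₂ (λ c l → j ∸ i ∸ c + 8 * s * l) (coveredSize-shift i S) (length-map _ S) ⟨
      costOver (8 * s) (j ∸ i) (map (mapPair shift) S)               ≡⟨ cong (costOver (8 * s) (j ∸ i)) shift-S≡ ⟩
      costOver (8 * s) (j ∸ i) T                                     ∎
      where open ≡-Reasoning

lemma6p9 : (A : Set) (_≟_ : DecidableEquality A) (bar : A → A)
    → (∀ a → bar (bar a) ≡ a) → (∀ a → bar a ≢ a)
    → (x : List A) (s : ℕ) .{{_ : NonZero s}}
    → ((i j : ℕ) → i ≤ j → j ≤ length x
        → Σ ℕ (λ v → IsFold bar (8 * s) (sub x i j) v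
            × D _≟_ bar x s (i / s) (j / s) + 3 * (j % s) ≤ 3 * (v + i % s)
            × v + i % s ≤ D _≟_ bar x s (i / s) (j / s) + j % s))
    × Σ ℕ (λ v → IsFold bar (8 * s) x v
        × v ≤ D _≟_ bar x s 0 (length x / s) + length x % s
        × D _≟_ bar x s 0 (length x / s) + length x % s ≤ 3 * v)
lemma6p9 A _≟_ bar bar-inv _ x s = bounds , whole
  where
  1≤8s : 1 ≤ 8 * s
  1≤8s = ≤-trans (>-nonZero⁻¹ s) (m≤m+n s _)
  bounds : ∀ i j → i ≤ j → j ≤ length x
         → Σ ℕ λ v → IsFold bar (8 * s) (sub x i j) v
                   × D _≟_ bar x s (i / s) (j / s) + 3 * (j % s) ≤ 3 * (v + i % s)
                   × v + i % s ≤ D _≟_ bar x s (i / s) (j / s) + j % s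
  bounds i j i≤j j≤ with fold-exists _≟_ bar (sub x i j) (8 * s) 1≤8s
  ... | v , isFold = v , isFold , fold-lower _≟_ bar bar-inv x s i j i≤j j≤ v isFold , fold-upper _≟_ bar bar-inv x s i j i≤j j≤ v isFold
  N = length x
  D₀ = D _≟_ bar x s 0 (N / s)
  whole : Σ ℕ λ v → IsFold bar (8 * s) x v × v ≤ D₀ + N % s × D₀ + N % s ≤ 3 * v
  whole with bounds 0 N z≤n ≤-refl
  ... | v , isFold , lower , upper =
    v , subst (λ y → IsFold bar (8 * s) y v) (take-all N x ≤-refl) isFold ,
    subst (_≤ D₀ + N % s) (+-identityʳ v) (subst₂ (λ r a → v + r ≤ D _≟_ bar x s a (N / s) + N % s) 0%s≡0 (0/n≡0 s) upper) ,
    ≤-trans (+-monoʳ-≤ D₀ (m≤m+n (N % s) _))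
            (subst (λ c → D₀ + 3 * (N % s) ≤ 3 * c) (+-identityʳ v)
              (subst₂ (λ r a → D _≟_ bar x s a (N / s) + 3 * (N % s) ≤ 3 * (v + r)) 0%s≡0 (0/n≡0 s) lower))
    where
    0%s≡0 : 0 % s ≡ 0
    0%s≡0 = proj₂ (divMod-* s 0)
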